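{- Let $q\ge5$ be prime, $q^*=(-1)^{(q-1)/2}q$, $u_q(j)=(3^j-q^*(-1)^j)/4$, and let $D_q(n)$ be the smallest positive integer $m$ such that $u_q(1),\ldots,u_q(n)$ are pairwise incongruent modulo $m$. Suppose $d>1$ and $d=D_q(n)$ for some $n\ge1$. Then $d=p^m$ for a prime $p$ with $p=2$ or $p>3$ and some $m\ge1$. Further, if $p>3$, then $\operatorname{ord}_{p^m}(9)=\varphi(p^m)/2$ and $\operatorname{ord}_p(9)=(p-1)/2$; if moreover $m\ge2$, then $3^{p-1}\not\equiv1\pmod{p^2}$; and if $p^m=q$, then $\operatorname{ord}_q(3)=q-1$.
   Context: $\operatorname{ord}_N(a)$ is the multiplicative order of $a$ modulo $N$, and $\varphi$ is Euler's totient function. -}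

module Defs where

open import Data.Nat as ℕ using (ℕ; zero; suc; _∸_; _≤_; _<_)
open import Data.Nat.Coprimality using (coprime?)
open import Data.Nat.Primality using (Prime)
open import Data.Integer as ℤ using (ℤ; +_; -_; _-_)
open import Data.Integer.Divisibility using (_∣_)
open import Data.List using (List; []; _∷_; length; filter; upTo; map)
open import Data.Product using (_×_)
open import Relation.Nullary using (¬_)

infix 4 _≡_[mod_]
_≡_[mod_] : ℤ → ℤ → ℕ → Set
x ≡ y [mod m ] = (+ m) ∣ (x - y)

qStar : ℕ → ℤ
qStar q = (ℤ.-1ℤ ℤ.^ ((q ∸ 1) ℕ./ 2)) ℤ.* (+ q)

-- u_q(j) = (3^j - q* (-1)^j) / 4   (exact division for prime q ≥ 5)
u : ℕ → ℕ → ℤ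
u q j = ((+ 3) ℤ.^ j - qStar q ℤ.* (ℤ.-1ℤ ℤ.^ j)) ℤ./ (+ 4)

PairwiseIncongruent : ℕ → ℕ → ℕ → Set
PairwiseIncongruent q n m =
  ∀ i j → 1 ≤ i → i ≤ n → 1 ≤ j → j ≤ n → i ≢ j → ¬ (u q i ≡ u q j [mod m ])
  where open import Relation.Binary.PropositionalEquality using (_≢_)

IsD : ℕ → ℕ → ℕ → Set
IsD q n d = 1 ≤ d × PairwiseIncongruent q n d
          × (∀ m → 1 ≤ m → m < d → ¬ PairwiseIncongruent q n m)

IsOrd : ℕ → ℕ → ℕ → Set
IsOrd N a k = 1 ≤ k × ((+ a) ℤ.^ k ≡ + 1 [mod N ])
            × (∀ j → 1 ≤ j → j < k → ¬ ((+ a) ℤ.^ j ≡ + 1 [mod N ]))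

φ : ℕ → ℕ
φ n = length (filter (λ k → coprime? k n) (map suc (upTo n)))

module Submission where

-- Let U(j) = 4 u_q(j) = 3^j - q* (-1)^j. Then U(i + 2t) - U(i) = 3^i (9^t - 1), consecutive
-- terms u(j), u(j + 1) have different parity, and U(j) ≡ 3^j (mod q). Since the 2-adic
-- valuation of 9^t - 1 is 3 + v₂(t), the terms u(1), …, u(n) are incongruent modulo the least
-- power of two that is ≥ n, so D < 2n. Write D = 2^b 3^c s with gcd(s, 6) = 1. Unless D is a
-- power of 2 or of a prime p ≥ 5, taking i ≥ c and t a multiple of 2^(b-1) and of the exponents
-- φ/2 given by Euler's theorem on the coprime parts of s makes 4D divide 3^i (9^t - 1), while
-- 2i + 4t ≤ D + 1 ≤ 2n; this is a collision u(i + 2t) ≡ u(i) inside 1, …, n. For D = p^a the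
-- same kind of collision rules out every exponent below the claimed orders, where lifting
-- 9^k ≡ 1 from p or p² to p^a multiplies k by a power of p.

open import Level using (0ℓ)
open import Data.Nat.Base as ℕ using (ℕ; zero; suc; _≤_; _<_; z≤n; s≤s; _∸_; NonZero)
import Data.Nat.Properties as ℕ
import Data.Nat.Divisibility as ℕ∣
open import Data.Nat.Coprimality as Coprimality using (Coprime; coprime-divisor; coprime-Bézout)
import Data.Nat.GCD as GCD
open import Data.Nat.DivMod using (_%_; m≡m%n+[m/n]*n; m%n≤m; m%n<n; m*n/n≡m)
open import Data.Nat.Primality using (Prime; prime⇒nonTrivial; prime⇒nonZero; prime⇒irreducible; ¬prime[0]; ¬prime[1]; prime[2]; prime?)
import Data.Nat.Tactic.RingSolver as ℕ-Solver
open import Data.Integer.Base as ℤ using (ℤ; +_)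
import Data.Integer.Properties as ℤ
import Data.Integer.Divisibility.Signed as ℤ∣
open import Data.Integer.Tactic.RingSolver using (solve-∀)
open import Data.Product using (_×_; _,_; ∃-syntax; proj₁; proj₂)
open import Data.Sum using (inj₁; inj₂)
open import Data.Empty using (⊥-elim)
open import Function.Base using (_∘_)
open import Relation.Binary.Bundles using (Setoid)
open import Relation.Binary.PropositionalEquality
open import Relation.Nullary.Decidable using (from-yes; from-no)
import Defs

module Arithmetic where

  open import Data.Integer.Base using (_*_; _^_)
  open import Data.Sum using (_⊎_)
  open import Relation.Nullary using (¬_)

  even-or-odd : ∀ n → (∃[ h ] n ≡ 2 ℕ.* h) ⊎ (∃[ h ] n ≡ suc (2 ℕ.* h))
  even-or-odd zero = inj₁ (0 , refl)
  even-or-odd (suc n) with even-or-odd n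
  ... | inj₁ (h , refl) = inj₂ (h , refl)
  ... | inj₂ (h , refl) = inj₁ (suc h , cong suc (sym (ℕ.+-suc h (h ℕ.+ 0))))

  -1ℤ^even : ∀ h → ℤ.-1ℤ ^ (2 ℕ.* h) ≡ + 1
  -1ℤ^even h = trans (sym (ℤ.^-*-assoc ℤ.-1ℤ 2 h)) (ℤ.^-zeroˡ h)

  -1ℤ^odd : ∀ h → ℤ.-1ℤ ^ suc (2 ℕ.* h) ≡ ℤ.-1ℤ
  -1ℤ^odd h = cong (ℤ.-1ℤ *_) (-1ℤ^even h)

  2*h≥1⇒h≥1 : ∀ {h} → 1 ≤ 2 ℕ.* h → 1 ≤ h
  2*h≥1⇒h≥1 {suc h} _ = s≤s z≤n

  half-double : ∀ h → (2 ℕ.* h) ℕ./ 2 ≡ h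
  half-double h = trans (cong (ℕ._/ 2) (ℕ.*-comm 2 h)) (m*n/n≡m h 2)

  2⊥odd : ∀ h → Coprime 2 (suc (2 ℕ.* h))
  2⊥odd h {0} (0∣2 , _) with ℕ∣.0∣⇒≡0 0∣2
  ... | ()
  2⊥odd h {1} _ = refl
  2⊥odd h {2} (_ , 2∣2h+1) =
    ⊥-elim (from-no (2 ℕ∣.∣? 1)
      (ℕ∣.∣m+n∣m⇒∣n (subst (2 ℕ∣.∣_) (ℕ.+-comm 1 (2 ℕ.* h)) 2∣2h+1) (ℕ∣.m∣m*n h)))
  2⊥odd h {suc (suc (suc d))} (d∣2 , _) with ℕ∣.∣⇒≤ d∣2
  ... | s≤s (s≤s ())

  pos-^ : ∀ a n → + (a ℕ.^ n) ≡ (+ a) ^ n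
  pos-^ a zero    = refl
  pos-^ a (suc n) = trans (ℤ.pos-* a (a ℕ.^ n)) (cong (+ a *_) (pos-^ a n))

  prime⇒≥2 : ∀ {p} → Prime p → 2 ≤ p
  prime⇒≥2 {p} p-prime = ℕ.nonTrivial⇒n>1 p {{prime⇒nonTrivial p-prime}}

  odd-prime : ∀ {p} → Prime p → 3 ≤ p → ∃[ h ] p ≡ suc (2 ℕ.* h)
  odd-prime p-prime 3≤p with even-or-odd _
  ... | inj₂ odd        = odd
  ... | inj₁ (h , refl) with prime⇒irreducible p-prime (ℕ∣.m∣m*n {2} h)
  ...   | inj₁ ()
  ...   | inj₂ 2≡2h = ⊥-elim (ℕ.<⇒≱ 3≤p (ℕ.≤-reflexive (sym 2≡2h)))

  ^-∣-^ : ∀ p {m n} → m ≤ n → p ℕ.^ m ℕ∣.∣ p ℕ.^ n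
  ^-∣-^ p {m} {n} m≤n = ℕ∣.divides (p ℕ.^ (n ∸ m))
    (trans (cong (p ℕ.^_) (sym (ℕ.m∸n+n≡m m≤n))) (ℕ.^-distribˡ-+-* p (n ∸ m) m))

  ∤⇒coprime : ∀ {p s} → Prime p → ¬ p ℕ∣.∣ s → Coprime p s
  ∤⇒coprime p-prime p∤s {e} (e∣p , e∣s) with prime⇒irreducible p-prime e∣p
  ... | inj₁ e≡1  = e≡1
  ... | inj₂ refl = ⊥-elim (p∤s e∣s)

  odd⇒≥3 : ∀ {s} → 2 ≤ s → ¬ 2 ℕ∣.∣ s → 3 ≤ s
  odd⇒≥3 {suc zero}          (s≤s ())
  odd⇒≥3 {suc (suc zero)}    _ 2∤2 = ⊥-elim (2∤2 ℕ∣.∣-refl)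
  odd⇒≥3 {suc (suc (suc _))} _ _   = s≤s (s≤s (s≤s z≤n))

  prime∤6⇒≥5 : ∀ {p} → Prime p → ¬ 2 ℕ∣.∣ p → ¬ 3 ℕ∣.∣ p → 5 ≤ p
  prime∤6⇒≥5 {0} p-prime _ _ = ⊥-elim (¬prime[0] p-prime)
  prime∤6⇒≥5 {1} p-prime _ _ = ⊥-elim (¬prime[1] p-prime)
  prime∤6⇒≥5 {2} _ 2∤2 _     = ⊥-elim (2∤2 ℕ∣.∣-refl)
  prime∤6⇒≥5 {3} _ _ 3∤3     = ⊥-elim (3∤3 ℕ∣.∣-refl)
  prime∤6⇒≥5 {4} _ 2∤4 _     = ⊥-elim (2∤4 (ℕ∣.divides 2 refl))
  prime∤6⇒≥5 {suc (suc (suc (suc (suc _))))} _ _ _ = s≤s (s≤s (s≤s (s≤s (s≤s z≤n))))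

  prime[3] : Prime 3
  prime[3] = from-yes (prime? 3)

  ∣⇒∤ : ∀ {k m s} → m ℕ∣.∣ s → ¬ k ℕ∣.∣ s → ¬ k ℕ∣.∣ m
  ∣⇒∤ m∣s k∤s k∣m = k∤s (ℕ∣.∣-trans k∣m m∣s)

module Congruence where

  open import Data.Integer.Base using (-_; _+_; _-_; _*_; _^_)
  open import Defs using (_≡_[mod_])

  infix 4 _≈_[mod_]
  record _≈_[mod_] (x y : ℤ) (m : ℕ) : Set where
    constructor mk
    field divides-difference : + m ℤ∣.∣ x - y
  open _≈_[mod_] public

  private
    ∣-subst : ∀ {m a b} → a ≡ b → + m ℤ∣.∣ a → + m ℤ∣.∣ b
    ∣-subst {m} = subst (+ m ℤ∣.∣_)

  ≈⇒≡[mod] : ∀ {m x y} → x ≈ y [mod m ] → x ≡ y [mod m ]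
  ≈⇒≡[mod] (mk p) = ℤ∣.∣⇒∣ᵤ p

  ≡[mod]⇒≈ : ∀ {m x y} → x ≡ y [mod m ] → x ≈ y [mod m ]
  ≡[mod]⇒≈ p = mk (ℤ∣.∣ᵤ⇒∣ p)

  ≈-refl : ∀ {m x} → x ≈ x [mod m ]
  ≈-refl {m} {x} = mk (∣-subst (sym (ℤ.+-inverseʳ x)) (ℤ∣.divides (+ 0) (sym (ℤ.*-zeroˡ (+ m)))))

  ≈-reflexive : ∀ {m x y} → x ≡ y → x ≈ y [mod m ]
  ≈-reflexive refl = ≈-refl

  ≈-sym : ∀ {m x y} → x ≈ y [mod m ] → y ≈ x [mod m ]
  ≈-sym {x = x} {y} (mk p) = mk (∣-subst (eq x y) (ℤ∣.∣m⇒∣-m p))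
    where eq : ∀ x y → - (x - y) ≡ y - x
          eq = solve-∀

  ≈-trans : ∀ {m x y z} → x ≈ y [mod m ] → y ≈ z [mod m ] → x ≈ z [mod m ]
  ≈-trans {x = x} {y} {z} (mk p) (mk q) = mk (∣-subst (eq x y z) (ℤ∣.∣m∣n⇒∣m+n p q))
    where eq : ∀ x y z → (x - y) + (y - z) ≡ x - z
          eq = solve-∀

  ≈-setoid : ℕ → Setoid 0ℓ 0ℓ
  ≈-setoid m = record
    { Carrier = ℤ
    ; _≈_ = _≈_[mod m ]
    ; isEquivalence = record { refl = ≈-refl ; sym = ≈-sym ; trans = ≈-trans }
    }

  module ≈-Reasoning (m : ℕ) where
    open import Relation.Binary.Reasoning.Setoid (≈-setoid m) public

  +-cong : ∀ {m a b c d} → a ≈ b [mod m ] → c ≈ d [mod m ] → a + c ≈ b + d [mod m ]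
  +-cong {a = a} {b} {c} {d} (mk p) (mk q) = mk (∣-subst (eq a b c d) (ℤ∣.∣m∣n⇒∣m+n p q))
    where eq : ∀ a b c d → (a - b) + (c - d) ≡ (a + c) - (b + d)
          eq = solve-∀

  -‿cong : ∀ {m a b} → a ≈ b [mod m ] → - a ≈ - b [mod m ]
  -‿cong {a = a} {b} (mk p) = mk (∣-subst (eq a b) (ℤ∣.∣m⇒∣-m p))
    where eq : ∀ a b → - (a - b) ≡ - a - - b
          eq = solve-∀

  -cong : ∀ {m a b c d} → a ≈ b [mod m ] → c ≈ d [mod m ] → a - c ≈ b - d [mod m ]
  -cong p q = +-cong p (-‿cong q)

  *-congˡ : ∀ {m a b} c → a ≈ b [mod m ] → c * a ≈ c * b [mod m ]
  *-congˡ {a = a} {b} c (mk p) = mk (∣-subst (eq a b c) (ℤ∣.∣n⇒∣m*n c p))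
    where eq : ∀ a b c → c * (a - b) ≡ c * a - c * b
          eq = solve-∀

  *-congʳ : ∀ {m a b} c → a ≈ b [mod m ] → a * c ≈ b * c [mod m ]
  *-congʳ {m} {a} {b} c p = subst₂ (_≈_[mod m ]) (ℤ.*-comm c a) (ℤ.*-comm c b) (*-congˡ c p)

  *-cong : ∀ {m a b c d} → a ≈ b [mod m ] → c ≈ d [mod m ] → a * c ≈ b * d [mod m ]
  *-cong {b = b} {c} p q = ≈-trans (*-congʳ c p) (*-congˡ b q)

  ^-cong : ∀ {m a b} n → a ≈ b [mod m ] → a ^ n ≈ b ^ n [mod m ]
  ^-cong zero    p = ≈-refl
  ^-cong (suc n) p = *-cong p (^-cong n p)

  ≈-∣-modulus : ∀ {m k x y} → k ℕ∣.∣ m → x ≈ y [mod m ] → x ≈ y [mod k ]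
  ≈-∣-modulus {m} {k} k∣m (mk p) = mk (ℤ∣.∣-trans (ℤ∣.∣ᵤ⇒∣ {+ k} {+ m} k∣m) p)

  ∣⇒≈0 : ∀ {m x} → + m ℤ∣.∣ x → x ≈ + 0 [mod m ]
  ∣⇒≈0 {x = x} p = mk (∣-subst (sym (ℤ.+-identityʳ x)) p)

  ≈0⇒∣ : ∀ {m x} → x ≈ + 0 [mod m ] → + m ℤ∣.∣ x
  ≈0⇒∣ {x = x} (mk p) = ∣-subst (ℤ.+-identityʳ x) p

  ℕ∣⇒≈0 : ∀ {m x} → m ℕ∣.∣ x → + x ≈ + 0 [mod m ]
  ℕ∣⇒≈0 {m} {x} p = ∣⇒≈0 (ℤ∣.∣ᵤ⇒∣ {+ m} {+ x} p)

  ≈0⇒ℕ∣ : ∀ {m x} → + x ≈ + 0 [mod m ] → m ℕ∣.∣ x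
  ≈0⇒ℕ∣ p = ℤ∣.∣⇒∣ᵤ (≈0⇒∣ p)

  *-modulus≈0 : ∀ {m} c → c * + m ≈ + 0 [mod m ]
  *-modulus≈0 c = ∣⇒≈0 (ℤ∣.divides c refl)

  ≈-1 : ∀ {x y} → x ≈ y [mod 1 ]
  ≈-1 {x} {y} = mk (ℤ∣.divides (x - y) (sym (ℤ.*-identityʳ (x - y))))

  ≈⇒-≈0 : ∀ {m x y} → x ≈ y [mod m ] → x - y ≈ + 0 [mod m ]
  ≈⇒-≈0 (mk p) = ∣⇒≈0 p

  -≈0⇒≈ : ∀ {m x y} → x - y ≈ + 0 [mod m ] → x ≈ y [mod m ]
  -≈0⇒≈ p = mk (≈0⇒∣ p)

  -≈⇒≈+ : ∀ {m x y z} → x - y ≈ z [mod m ] → x ≈ y + z [mod m ]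
  -≈⇒≈+ {m} {x} {y} {z} p = ≈-trans (≈-reflexive (eq x y)) (+-cong (≈-refl {x = y}) p)
    where eq : ∀ x y → x ≡ y + (x - y)
          eq = solve-∀

  ≈+⇒-≈ : ∀ {m x y z} → x ≈ y + z [mod m ] → x - y ≈ z [mod m ]
  ≈+⇒-≈ {m} {x} {y} {z} p = ≈-trans (-cong p (≈-refl {x = y})) (≈-reflexive (eq y z))
    where eq : ∀ y z → y + z - y ≡ z
          eq = solve-∀

  *-pres-≈0 : ∀ {a b x y} → x ≈ + 0 [mod a ] → y ≈ + 0 [mod b ] → x * y ≈ + 0 [mod a ℕ.* b ]
  *-pres-≈0 {a} {b} {x} {y} p q = ∣⇒≈0 (ℤ∣.divides (s * t) eq)
    where
      open ℤ∣._∣_ (≈0⇒∣ p) renaming (quotient to s; equality to x≡s*a)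
      open ℤ∣._∣_ (≈0⇒∣ q) renaming (quotient to t; equality to y≡t*b)
      eq : x * y ≡ (s * t) * + (a ℕ.* b)
      eq = begin
        x * y                      ≡⟨ cong₂ _*_ x≡s*a y≡t*b ⟩
        (s * + a) * (t * + b)      ≡⟨ swap s t (+ a) (+ b) ⟩
        (s * t) * (+ a * + b)      ≡⟨ cong ((s * t) *_) (ℤ.pos-* a b) ⟨
        (s * t) * + (a ℕ.* b)      ∎
        where
          open ≡-Reasoning
          swap : ∀ s t a b → (s * a) * (t * b) ≡ (s * t) * (a * b)
          swap = solve-∀

  private
    ∣-*-difference : ∀ c x y → ℤ.∣ + c * x - + c * y ∣ ≡ c ℕ.* ℤ.∣ x - y ∣
    ∣-*-difference c x y = trans (cong ℤ.∣_∣ (eq (+ c) x y)) (ℤ.abs-* (+ c) (x - y))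
      where eq : ∀ c x y → c * x - c * y ≡ c * (x - y)
            eq = solve-∀

  *-cancelˡ-coprime : ∀ {m a} x y → Coprime a m → + a * x ≈ + a * y [mod m ] → x ≈ y [mod m ]
  *-cancelˡ-coprime {m} {a} x y a⊥m (mk p) =
    mk (ℤ∣.∣ᵤ⇒∣ {+ m} {x - y} (coprime-divisor (Coprimality.sym a⊥m)
      (subst (m ℕ∣.∣_) (∣-*-difference a x y) (ℤ∣.∣⇒∣ᵤ p))))

  *-cancel-modulus : ∀ c {m x y} .{{_ : NonZero c}} →
    + c * x ≈ + c * y [mod c ℕ.* m ] → x ≈ y [mod m ]
  *-cancel-modulus c {m} {x} {y} (mk p) =
    mk (ℤ∣.∣ᵤ⇒∣ {+ m} {x - y} (ℕ∣.*-cancelˡ-∣ c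
      (subst (c ℕ.* m ℕ∣.∣_) (∣-*-difference c x y) (ℤ∣.∣⇒∣ᵤ p))))

  *-cong-modulus : ∀ c {m x y} → x ≈ y [mod m ] → + c * x ≈ + c * y [mod c ℕ.* m ]
  *-cong-modulus c {m} {x} {y} (mk p) =
    mk (ℤ∣.∣ᵤ⇒∣ {+ (c ℕ.* m)} {+ c * x - + c * y}
      (subst (c ℕ.* m ℕ∣.∣_) (sym (∣-*-difference c x y)) (ℕ∣.*-monoʳ-∣ c (ℤ∣.∣⇒∣ᵤ p))))

  ≈⇒∣∸ : ∀ {m x y} → x ≤ y → + y ≈ + x [mod m ] → m ℕ∣.∣ y ∸ x
  ≈⇒∣∸ {m} {x} {y} x≤y (mk p) =
    ℤ∣.∣⇒∣ᵤ (∣-subst (trans (ℤ.m-n≡m⊖n y x) (ℤ.⊖-≥ x≤y)) p)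

  ∣∸⇒≈ : ∀ {m x y} → x ≤ y → m ℕ∣.∣ y ∸ x → + y ≈ + x [mod m ]
  ∣∸⇒≈ {m} {x} {y} x≤y p =
    mk (∣-subst (sym (trans (ℤ.m-n≡m⊖n y x) (ℤ.⊖-≥ x≤y))) (ℤ∣.∣ᵤ⇒∣ {+ m} {+ (y ∸ x)} p))

  %-≈ : ∀ m .{{_ : NonZero m}} x → + (x % m) ≈ + x [mod m ]
  %-≈ m x = ≈-sym (∣∸⇒≈ (m%n≤m x m) (subst (m ℕ∣.∣_) (sym x∸x%m≡) (ℕ∣.n∣m*n (x ℕ./ m))))
    where
      x∸x%m≡ : x ∸ x % m ≡ x ℕ./ m ℕ.* m
      x∸x%m≡ = trans (cong (_∸ x % m) (m≡m%n+[m/n]*n x m)) (ℕ.m+n∸m≡n (x % m) (x ℕ./ m ℕ.* m))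

  ∣∧<⇒≡0 : ∀ {m k} → m ℕ∣.∣ k → k < m → k ≡ 0
  ∣∧<⇒≡0 {k = zero}  _   _   = refl
  ∣∧<⇒≡0 {k = suc k} m∣k k<m = ⊥-elim (ℕ.<⇒≱ k<m (ℕ∣.∣⇒≤ m∣k))

  private
    ≈⇒≡-≤ : ∀ {m x y} → x ≤ y → y < m → + y ≈ + x [mod m ] → y ≡ x
    ≈⇒≡-≤ {m} {x} {y} x≤y y<m p = begin
      y           ≡⟨ ℕ.m∸n+n≡m x≤y ⟨
      y ∸ x ℕ.+ x ≡⟨ cong (ℕ._+ x) (∣∧<⇒≡0 (≈⇒∣∸ x≤y p) (ℕ.≤-<-trans (ℕ.m∸n≤m y x) y<m)) ⟩
      x           ∎
      where open ≡-Reasoning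

  ≈⇒≡-< : ∀ {m x y} → x < m → y < m → + x ≈ + y [mod m ] → x ≡ y
  ≈⇒≡-< {x = x} {y} x<m y<m p with ℕ.≤-total x y
  ... | inj₁ x≤y = sym (≈⇒≡-≤ x≤y y<m (≈-sym p))
  ... | inj₂ y≤x = ≈⇒≡-≤ y≤x x<m p

module CoprimeResidues where

  open import Data.Integer.Base using (-_; _+_; _-_; _*_)
  open import Data.List.Base using (List; []; _∷_)
  open import Data.List.Relation.Unary.All using (All; []; _∷_)
  open import Data.Nat.ListAction using (product)
  open Congruence

  coprime-∣ʳ : ∀ {a m d} → Coprime a m → d ℕ∣.∣ m → Coprime a d
  coprime-∣ʳ a⊥m d∣m (e∣a , e∣d) = a⊥m (e∣a , ℕ∣.∣-trans e∣d d∣m)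

  coprime-*ˡ : ∀ {a b m} → Coprime a m → Coprime b m → Coprime (a ℕ.* b) m
  coprime-*ˡ a⊥m b⊥m (e∣ab , e∣m) =
    b⊥m (coprime-divisor (Coprimality.sym (coprime-∣ʳ a⊥m e∣m)) e∣ab , e∣m)

  coprime-^ˡ : ∀ {a m} k → Coprime a m → Coprime (a ℕ.^ k) m
  coprime-^ˡ zero    _   = Coprimality.1-coprimeTo _
  coprime-^ˡ (suc k) a⊥m = coprime-*ˡ a⊥m (coprime-^ˡ k a⊥m)

  coprime-product : ∀ {m} (xs : List ℕ) → All (λ x → Coprime x m) xs → Coprime (product xs) m
  coprime-product []       []           = Coprimality.1-coprimeTo _
  coprime-product (x ∷ xs) (x⊥m ∷ xs⊥m) = coprime-*ˡ x⊥m (coprime-product xs xs⊥m)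

  ≈-coprime : ∀ {m x y} → Coprime x m → + y ≈ + x [mod m ] → Coprime y m
  ≈-coprime x⊥m y≈x (e∣y , e∣m) =
    x⊥m (≈0⇒ℕ∣ (≈-trans (≈-sym (≈-∣-modulus e∣m y≈x)) (ℕ∣⇒≈0 e∣y)) , e∣m)

  inverse : ∀ {m a} → Coprime a m → ∃[ b ] + a * + b ≈ + 1 [mod m ]
  inverse {m} {a} a⊥m with coprime-Bézout a⊥m
  ... | GCD.Bézout.+- x y 1+ym≡xa =
    x , ≈-trans (≈-reflexive (trans (ℤ.*-comm (+ a) (+ x)) (sym (ℤ.pos-* x a))))
                (-≈0⇒≈ (∣⇒≈0 (ℤ∣.divides (+ y) xa-1≡)))
    where
      xa-1≡ : + (x ℕ.* a) - + 1 ≡ + y * + m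
      xa-1≡ = begin
        + (x ℕ.* a) - + 1           ≡⟨ cong (λ z → + z - + 1) 1+ym≡xa ⟨
        + (1 ℕ.+ y ℕ.* m) - + 1     ≡⟨ cong (λ z → + 1 + z - + 1) (ℤ.pos-* y m) ⟩
        + 1 + + y * + m - + 1       ≡⟨ cancel (+ y * + m) ⟩
        + y * + m                   ∎
        where
          open ≡-Reasoning
          cancel : ∀ z → + 1 + z - + 1 ≡ z
          cancel = solve-∀
  -- x a ≡ -1 gives a (x a x) = (x a)² ≡ 1.
  ... | GCD.Bézout.-+ x y 1+xa≡ym = x ℕ.* a ℕ.* x , ≈-trans (≈-reflexive square) (*-cong xa≈-1 xa≈-1)
    where
      xa≈-1 : + (x ℕ.* a) ≈ - + 1 [mod m ]
      xa≈-1 = mk (ℤ∣.divides (+ y) (begin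
        + (x ℕ.* a) - - + 1         ≡⟨ plus1 (+ (x ℕ.* a)) ⟩
        + (1 ℕ.+ x ℕ.* a)          ≡⟨ cong +_ 1+xa≡ym ⟩
        + (y ℕ.* m)                 ≡⟨ ℤ.pos-* y m ⟩
        + y * + m                   ∎))
        where
          open ≡-Reasoning
          plus1 : ∀ z → z - - + 1 ≡ + 1 + z
          plus1 = solve-∀
      square : + a * + (x ℕ.* a ℕ.* x) ≡ + (x ℕ.* a) * + (x ℕ.* a)
      square = begin
        + a * + (x ℕ.* a ℕ.* x)           ≡⟨ ℤ.pos-* a (x ℕ.* a ℕ.* x) ⟨
        + (a ℕ.* (x ℕ.* a ℕ.* x))          ≡⟨ cong +_ (reorder a x) ⟩
        + (x ℕ.* a ℕ.* (x ℕ.* a))          ≡⟨ ℤ.pos-* (x ℕ.* a) (x ℕ.* a) ⟩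
        + (x ℕ.* a) * + (x ℕ.* a)          ∎
        where
          open ≡-Reasoning
          reorder : ∀ a x → a ℕ.* (x ℕ.* a ℕ.* x) ≡ x ℕ.* a ℕ.* (x ℕ.* a)
          reorder = ℕ-Solver.solve-∀

  ≈0-coprime-* : ∀ {a b x} → Coprime a b → x ≈ + 0 [mod a ] → x ≈ + 0 [mod b ] → x ≈ + 0 [mod a ℕ.* b ]
  ≈0-coprime-* {a} {b} {x} a⊥b x≈0[a] x≈0[b] = ∣⇒≈0 (ℤ∣.∣ᵤ⇒∣ {+ (a ℕ.* b)} {x}
      (subst (a ℕ.* b ℕ∣.∣_) (sym ∣x∣≡a*k) (ℕ∣.*-monoʳ-∣ a b∣k)))
    where
      a∣x : a ℕ∣.∣ ℤ.∣ x ∣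
      a∣x = ℤ∣.∣⇒∣ᵤ (≈0⇒∣ x≈0[a])
      k : ℕ
      k = ℕ∣.quotient a∣x
      ∣x∣≡a*k : ℤ.∣ x ∣ ≡ a ℕ.* k
      ∣x∣≡a*k = ℕ∣.m∣n⇒n≡m*quotient a∣x
      b∣k : b ℕ∣.∣ k
      b∣k = coprime-divisor (Coprimality.sym a⊥b) (subst (b ℕ∣.∣_) ∣x∣≡a*k (ℤ∣.∣⇒∣ᵤ (≈0⇒∣ x≈0[b])))

  ≈1-coprime-* : ∀ {a b x} → Coprime a b → x ≈ + 1 [mod a ] → x ≈ + 1 [mod b ] → x ≈ + 1 [mod a ℕ.* b ]
  ≈1-coprime-* a⊥b x≈1[a] x≈1[b] = -≈0⇒≈ (≈0-coprime-* a⊥b (≈⇒-≈0 x≈1[a]) (≈⇒-≈0 x≈1[b]))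

module Totient where

  open import Data.Integer.Base using (_+_; _-_; _*_; _^_)
  open import Data.List.Base using (List; []; _∷_; _++_; length; filter; upTo; map)
  import Data.List.Properties as List
  open import Data.List.Membership.Propositional using (_∈_)
  open import Data.List.Membership.Propositional.Properties
    using (∈-filter⁺; ∈-filter⁻; ∈-map⁺; ∈-map⁻; ∈-upTo⁺; ∈-upTo⁻)
  open import Data.List.Membership.Propositional.Properties.WithK using (unique∧set⇒bag)
  open import Data.List.Relation.Unary.All as All using (All)
  open import Data.List.Relation.Unary.Any as Any using (here; there)
  open import Data.List.Relation.Unary.AllPairs using ([]; _∷_)
  open import Data.List.Relation.Unary.Unique.Propositional using (Unique)
  import Data.List.Relation.Unary.Unique.Propositional.Properties as Unique
  open import Data.List.Relation.Binary.BagAndSetEquality using (∼bag⇒↭)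
  open import Data.List.Relation.Binary.Permutation.Propositional using (_↭_)
  open import Data.Nat.ListAction using (product)
  open import Data.Nat.ListAction.Properties using (product-↭)
  open import Function.Bundles using (mk⇔)
  open import Relation.Nullary using (¬_; Dec)
  open import Defs using (φ)
  open Congruence
  open CoprimeResidues
  open Arithmetic

  map-↭ : ∀ {A : Set} {f : A → A} {xs : List A} → Unique xs →
    (∀ {x} → x ∈ xs → f x ∈ xs) →
    (∀ {x y} → x ∈ xs → y ∈ xs → f x ≡ f y → x ≡ y) →
    (∀ {y} → y ∈ xs → ∃[ x ] x ∈ xs × y ≡ f x) →
    map f xs ↭ xs
  map-↭ {f = f} {xs} xs! into injective onto =
    ∼bag⇒↭ (unique∧set⇒bag (unique-map xs xs! (λ x∈ y∈ → injective x∈ y∈)) xs! (mk⇔ to from))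
    where
      unique-map : ∀ ys → Unique ys → (∀ {x y} → x ∈ ys → y ∈ ys → f x ≡ f y → x ≡ y) → Unique (map f ys)
      unique-map []       _           _   = []
      unique-map (y ∷ ys) (y∉ys ∷ ys!) inj =
        All.tabulate fy≢ ∷ unique-map ys ys! (λ x∈ z∈ → inj (there x∈) (there z∈))
        where
          fy≢ : ∀ {z} → z ∈ map f ys → f y ≢ z
          fy≢ z∈ fy≡z with ∈-map⁻ f z∈
          ... | w , w∈ , z≡fw = All.lookup y∉ys w∈ (inj (here refl) (there w∈) (trans fy≡z z≡fw))
      to : ∀ {z} → z ∈ map f xs → z ∈ xs
      to z∈ with ∈-map⁻ f z∈
      ... | w , w∈ , refl = into w∈
      from : ∀ {z} → z ∈ xs → z ∈ map f xs
      from z∈ with onto z∈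
      ... | w , w∈ , refl = ∈-map⁺ f w∈

  product-map-≈ : ∀ {m} a (f : ℕ → ℕ) → (∀ x → + f x ≈ + a * + x [mod m ]) → (xs : List ℕ) →
    + product (map f xs) ≈ (+ a) ^ length xs * + product xs [mod m ]
  product-map-≈ a f f≈ []       = ≈-refl
  product-map-≈ {m} a f f≈ (x ∷ xs) = begin
    + (f x ℕ.* product (map f xs))                         ≡⟨ ℤ.pos-* (f x) _ ⟩
    + f x * + product (map f xs)                           ≈⟨ *-cong (f≈ x) (product-map-≈ a f f≈ xs) ⟩
    (+ a * + x) * ((+ a) ^ length xs * + product xs)        ≡⟨ reorder (+ a) (+ x) ((+ a) ^ length xs) (+ product xs) ⟩
    (+ a * (+ a) ^ length xs) * (+ x * + product xs)        ≡⟨ cong ((+ a * (+ a) ^ length xs) *_) (ℤ.pos-* x _) ⟨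
    (+ a) ^ length (x ∷ xs) * + product (x ∷ xs)            ∎
    where
      open ≈-Reasoning m
      reorder : ∀ a x p q → (a * x) * (p * q) ≡ (a * p) * (x * q)
      reorder = solve-∀

  private
    coprime-to? : ∀ m k → Dec (Coprime k m)
    coprime-to? m k = Coprimality.coprime? k m

  -- φ m unfolds to length (units m).
  units : ℕ → List ℕ
  units m = filter (coprime-to? m) (map suc (upTo m))

  ¬coprime-self : ∀ {m} → 2 ≤ m → ¬ Coprime m m
  ¬coprime-self {suc (suc _)} _ m⊥m with m⊥m (ℕ∣.∣-refl , ℕ∣.∣-refl)
  ... | ()
  ¬coprime-self {suc zero} (s≤s ())

  units-unique : ∀ m → Unique (units m)
  units-unique m = Unique.filter⁺ (coprime-to? m) (Unique.map⁺ ℕ.suc-injective (Unique.upTo⁺ m))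

  ∈-units⁺ : ∀ {m x} → 1 ≤ x → x < m → Coprime x m → x ∈ units m
  ∈-units⁺ {m} {suc x} _ x<m x⊥m = ∈-filter⁺ (coprime-to? m) (∈-map⁺ suc (∈-upTo⁺ (ℕ.<-trans (ℕ.n<1+n x) x<m))) x⊥m

  ∈-units⁻ : ∀ {m x} → 2 ≤ m → x ∈ units m → x < m × Coprime x m
  ∈-units⁻ {m} 2≤m x∈ with ∈-filter⁻ (coprime-to? m) {xs = map suc (upTo m)} x∈
  ... | x∈1…m , x⊥m with ∈-map⁻ suc x∈1…m
  ... | y , y∈ , refl with ℕ.m≤n⇒m<n∨m≡n (∈-upTo⁻ y∈)
  ...   | inj₁ y+1<m = y+1<m , x⊥m
  ...   | inj₂ refl  = ⊥-elim (¬coprime-self 2≤m x⊥m)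

  coprime⇒≥1 : ∀ {x m} → 2 ≤ m → Coprime x m → 1 ≤ x
  coprime⇒≥1 {zero}  {suc zero}    (s≤s ())
  coprime⇒≥1 {zero}  {suc (suc _)} _ 0⊥m = ⊥-elim (Coprimality.¬0-coprimeTo-2+ 0⊥m)
  coprime⇒≥1 {suc x}               _ _   = s≤s z≤n

  -- Multiplication by a unit permutes the units, so a^φ(m) ∏ units ≡ ∏ units.
  module _ {m a : ℕ} .{{_ : NonZero m}} (2≤m : 2 ≤ m) (a⊥m : Coprime a m) where

    private
      times-a : ℕ → ℕ
      times-a x = (a ℕ.* x) % m

      times-a≈ : ∀ x → + times-a x ≈ + a * + x [mod m ]
      times-a≈ x = ≈-trans (%-≈ m (a ℕ.* x)) (≈-reflexive (ℤ.pos-* a x))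

      unit⇒∈ : ∀ {x} → x < m → Coprime x m → x ∈ units m
      unit⇒∈ x<m x⊥m = ∈-units⁺ (coprime⇒≥1 2≤m x⊥m) x<m x⊥m

      into : ∀ {x} → x ∈ units m → times-a x ∈ units m
      into {x} x∈ = unit⇒∈ (m%n<n (a ℕ.* x) m)
        (≈-coprime (coprime-*ˡ a⊥m (proj₂ (∈-units⁻ 2≤m x∈))) (%-≈ m (a ℕ.* x)))

      injective : ∀ {x y} → x ∈ units m → y ∈ units m → times-a x ≡ times-a y → x ≡ y
      injective {x} {y} x∈ y∈ ax≡ay =
        ≈⇒≡-< (proj₁ (∈-units⁻ 2≤m x∈)) (proj₁ (∈-units⁻ 2≤m y∈))
          (*-cancelˡ-coprime (+ x) (+ y) a⊥m
            (≈-trans (≈-sym (times-a≈ x)) (≈-trans (≈-reflexive (cong +_ ax≡ay)) (times-a≈ y))))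

      b : ℕ
      b = proj₁ (inverse a⊥m)

      ab≈1 : + a * + b ≈ + 1 [mod m ]
      ab≈1 = proj₂ (inverse a⊥m)

      b⊥m : Coprime b m
      b⊥m (e∣b , e∣m) = ab⊥m (ℕ∣.∣n⇒∣m*n a e∣b , e∣m)
        where
          ab⊥m : Coprime (a ℕ.* b) m
          ab⊥m = ≈-coprime (Coprimality.1-coprimeTo m) (≈-trans (≈-reflexive (ℤ.pos-* a b)) ab≈1)

      onto : ∀ {y} → y ∈ units m → ∃[ x ] x ∈ units m × y ≡ times-a x
      onto {y} y∈ = x , unit⇒∈ (m%n<n (b ℕ.* y) m) x⊥m ,
          ≈⇒≡-< (proj₁ (∈-units⁻ 2≤m y∈)) (m%n<n (a ℕ.* x) m) (≈-sym ax≈y)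
        where
          x : ℕ
          x = (b ℕ.* y) % m
          x⊥m : Coprime x m
          x⊥m = ≈-coprime (coprime-*ˡ b⊥m (proj₂ (∈-units⁻ 2≤m y∈))) (%-≈ m (b ℕ.* y))
          ax≈y : + times-a x ≈ + y [mod m ]
          ax≈y = begin
            + times-a x            ≈⟨ times-a≈ x ⟩
            + a * + x              ≈⟨ *-congˡ (+ a) (%-≈ m (b ℕ.* y)) ⟩
            + a * + (b ℕ.* y)      ≡⟨ cong (+ a *_) (ℤ.pos-* b y) ⟩
            + a * (+ b * + y)      ≡⟨ ℤ.*-assoc (+ a) (+ b) (+ y) ⟨
            (+ a * + b) * + y      ≈⟨ *-congʳ (+ y) ab≈1 ⟩
            + 1 * + y              ≡⟨ ℤ.*-identityˡ (+ y) ⟩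
            + y                    ∎
            where open ≈-Reasoning m

    euler-≥2 : (+ a) ^ φ m ≈ + 1 [mod m ]
    euler-≥2 = *-cancelˡ-coprime _ _ (coprime-product (units m) (All.tabulate (λ x∈ → proj₂ (∈-units⁻ 2≤m x∈)))) (begin
      + P * (+ a) ^ φ m                         ≡⟨ ℤ.*-comm (+ P) _ ⟩
      (+ a) ^ length (units m) * + P            ≈⟨ product-map-≈ a times-a times-a≈ (units m) ⟨
      + product (map times-a (units m))         ≡⟨ cong +_ (product-↭ (map-↭ (units-unique m) into injective onto)) ⟩
      + P                                       ≡⟨ ℤ.*-identityʳ (+ P) ⟨
      + P * + 1                                 ∎)
      where
        open ≈-Reasoning m
        P : ℕ
        P = product (units m)

  euler : ∀ m a → Coprime a m → (+ a) ^ φ m ≈ + 1 [mod m ]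
  euler zero                a _   = ≈-refl
  euler (suc zero)          a _   = ≈-1
  euler m@(suc (suc _)) a a⊥m = euler-≥2 (s≤s (s≤s z≤n)) a⊥m

  φ≥1 : ∀ m → 1 ≤ m → 1 ≤ φ m
  φ≥1 m@(suc _) _ = List.filter-some (coprime-to? m) (Any.map (λ { refl {d} → Coprimality.1-coprimeTo m {d} }) 1∈)
    where
      1∈ : 1 ∈ map suc (upTo m)
      1∈ = ∈-map⁺ suc (∈-upTo⁺ (s≤s z≤n))

  φ<n : ∀ m → 2 ≤ m → φ m < m
  φ<n m@(suc n) 2≤m = subst (φ m <_) length-1…m
      (List.filter-notAll (coprime-to? m) (map suc (upTo m)) (Any.map (λ { refl → ¬coprime-self 2≤m }) m∈))
    where
      m∈ : m ∈ map suc (upTo m)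
      m∈ = ∈-map⁺ suc (∈-upTo⁺ ℕ.≤-refl)
      length-1…m : length (map suc (upTo m)) ≡ m
      length-1…m = trans (List.length-map suc (upTo m)) (List.length-upTo m)

  φ-prime : ∀ {p} → Prime p → φ p ≡ p ∸ 1
  φ-prime {suc n} p-prime = begin
    length (filter P? (map suc (upTo (suc n))))               ≡⟨ cong (length ∘ filter P?) 1…n+1≡ ⟩
    length (filter P? (map suc (upTo n) ++ suc n ∷ []))       ≡⟨ cong length (List.filter-++ P? (map suc (upTo n)) _) ⟩
    length (filter P? (map suc (upTo n)) ++ filter P? (suc n ∷ []))
                                                            ≡⟨ List.length-++ (filter P? (map suc (upTo n))) ⟩
    length (filter P? (map suc (upTo n))) ℕ.+ length (filter P? (suc n ∷ []))
      ≡⟨ cong₂ (λ xs ys → length xs ℕ.+ length ys)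
               (List.filter-all P? (All.tabulate below-p-coprime))
               (List.filter-reject P? (¬coprime-self (prime⇒≥2 p-prime))) ⟩
    length (map suc (upTo n)) ℕ.+ 0                           ≡⟨ ℕ.+-identityʳ _ ⟩
    length (map suc (upTo n))                                 ≡⟨ List.length-map suc (upTo n) ⟩
    length (upTo n)                                           ≡⟨ List.length-upTo n ⟩
    n                                                         ∎
    where
      open ≡-Reasoning
      P? : ∀ k → Dec (Coprime k (suc n))
      P? = coprime-to? (suc n)
      1…n+1≡ : map suc (upTo (suc n)) ≡ map suc (upTo n) ++ suc n ∷ []
      1…n+1≡ = trans (cong (map suc) (sym (List.upTo-∷ʳ n))) (List.map-++ suc (upTo n) (n ∷ []))
      below-p-coprime : ∀ {x} → x ∈ map suc (upTo n) → Coprime x (suc n)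
      below-p-coprime x∈ with ∈-map⁻ suc x∈
      ... | y , y∈ , refl = Coprimality.sym (Coprimality.prime⇒coprime p-prime (s≤s (∈-upTo⁻ y∈)))

  -- Otherwise (m - 1)^φ(m) ≡ 1 with m - 1 ≡ -1 gives -1 ≡ 1, i.e. m ∣ 2.
  φ-even : ∀ m → 3 ≤ m → ∃[ h ] φ m ≡ 2 ℕ.* h
  φ-even m@(suc k) 3≤m with even-or-odd (φ m)
  ... | inj₁ even = even
  ... | inj₂ (h , φ≡2h+1) = ⊥-elim (ℕ.<⇒≱ 3≤m (ℕ∣.∣⇒≤ (≈0⇒ℕ∣ 2≈0)))
    where
      k≈-1 : + k ≈ ℤ.-1ℤ [mod m ]
      k≈-1 = mk (ℤ∣.divides (+ 1) (trans (k+1 (+ k)) (sym (ℤ.*-identityˡ (+ m)))))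
        where k+1 : ∀ x → x - ℤ.-1ℤ ≡ + 1 + x
              k+1 = solve-∀
      k⊥m : Coprime k m
      k⊥m {d} (d∣k , d∣k+1) = ℕ∣.∣1⇒≡1 (ℕ∣.∣m+n∣m⇒∣n (subst (d ℕ∣.∣_) (ℕ.+-comm 1 k) d∣k+1) d∣k)
      -1≈1 : ℤ.-1ℤ ≈ + 1 [mod m ]
      -1≈1 = begin
        ℤ.-1ℤ                   ≡⟨ -1ℤ^odd h ⟨
        ℤ.-1ℤ ^ suc (2 ℕ.* h)   ≡⟨ cong (ℤ.-1ℤ ^_) φ≡2h+1 ⟨
        ℤ.-1ℤ ^ φ m             ≈⟨ ^-cong (φ m) k≈-1 ⟨
        (+ k) ^ φ m             ≈⟨ euler m k k⊥m ⟩
        + 1                     ∎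
        where open ≈-Reasoning m
      2≈0 : + 2 ≈ + 0 [mod m ]
      2≈0 = ≈⇒-≈0 (≈-sym -1≈1)

  half-totient : ∀ m → 3 ≤ m → ∃[ g ] φ m ≡ 2 ℕ.* g × 1 ≤ g × 2 ℕ.* g < m
  half-totient m 3≤m with φ-even m 3≤m
  ... | g , φ≡2g = g , φ≡2g , 2*h≥1⇒h≥1 (subst (1 ≤_) φ≡2g (φ≥1 m (ℕ.≤-trans (s≤s z≤n) 3≤m))) ,
                   subst (_< m) φ≡2g (φ<n m (ℕ.≤-trans (s≤s (s≤s z≤n)) 3≤m))

module Order where

  open import Data.Integer.Base using (_*_; _^_)
  open import Relation.Nullary using (¬_)
  open import Defs using (IsOrd; _≡_[mod_])
  open Congruence

  ^-*-≈1 : ∀ {m x} a k → x ^ a ≈ + 1 [mod m ] → x ^ (a ℕ.* k) ≈ + 1 [mod m ]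
  ^-*-≈1 {m} {x} a k xᵃ≈1 = begin
    x ^ (a ℕ.* k)   ≡⟨ ℤ.^-*-assoc x a k ⟨
    (x ^ a) ^ k     ≈⟨ ^-cong k xᵃ≈1 ⟩
    (+ 1) ^ k       ≡⟨ ℤ.^-zeroˡ k ⟩
    + 1             ∎
    where open ≈-Reasoning m

  ^-*-≈1′ : ∀ {m x} a k → x ^ a ≈ + 1 [mod m ] → x ^ (k ℕ.* a) ≈ + 1 [mod m ]
  ^-*-≈1′ {m} {x} a k xᵃ≈1 = subst (λ e → x ^ e ≈ + 1 [mod m ]) (ℕ.*-comm a k) (^-*-≈1 a k xᵃ≈1)

  ^-+-≈1 : ∀ {m x} a b → x ^ (a ℕ.+ b) ≈ + 1 [mod m ] → x ^ b ≈ + 1 [mod m ] → x ^ a ≈ + 1 [mod m ]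
  ^-+-≈1 {m} {x} a b xᵃ⁺ᵇ≈1 xᵇ≈1 = begin
    x ^ a              ≡⟨ ℤ.*-identityʳ (x ^ a) ⟨
    x ^ a * + 1        ≈⟨ *-congˡ (x ^ a) xᵇ≈1 ⟨
    x ^ a * x ^ b      ≡⟨ ℤ.^-distribˡ-+-* x a b ⟨
    x ^ (a ℕ.+ b)      ≈⟨ xᵃ⁺ᵇ≈1 ⟩
    + 1                ∎
    where open ≈-Reasoning m

  ^-gcd-≈1 : ∀ {m x} a b → x ^ a ≈ + 1 [mod m ] → x ^ b ≈ + 1 [mod m ] → x ^ GCD.gcd a b ≈ + 1 [mod m ]
  ^-gcd-≈1 {m} {x} a b xᵃ≈1 xᵇ≈1 with GCD.Bézout.identity (GCD.gcd-GCD a b)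
  ... | GCD.Bézout.+- u v g+vb≡ua =
    ^-+-≈1 (GCD.gcd a b) (v ℕ.* b)
      (subst (λ e → x ^ e ≈ + 1 [mod m ]) (sym g+vb≡ua) (^-*-≈1′ a u xᵃ≈1)) (^-*-≈1′ b v xᵇ≈1)
  ... | GCD.Bézout.-+ u v g+ua≡vb =
    ^-+-≈1 (GCD.gcd a b) (u ℕ.* a)
      (subst (λ e → x ^ e ≈ + 1 [mod m ]) (sym g+ua≡vb) (^-*-≈1′ b v xᵇ≈1)) (^-*-≈1′ a u xᵃ≈1)

  proper-divisor-≤-half : ∀ {g l} → g ℕ∣.∣ l → g < l → 2 ℕ.* g ≤ l
  proper-divisor-≤-half (ℕ∣.divides zero refl) g<0 = ⊥-elim (ℕ.n≮0 g<0)
  proper-divisor-≤-half {g} (ℕ∣.divides (suc zero) refl) g<g = ⊥-elim (ℕ.<-irrefl (sym (ℕ.+-identityʳ g)) g<g)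
  proper-divisor-≤-half {g} (ℕ∣.divides (suc (suc c)) refl) _ = ℕ.*-monoˡ-≤ g {2} {suc (suc c)} (s≤s (s≤s z≤n))

  ≈1-below⇒≈1-half : ∀ {m x} k l → 1 ≤ k → k < l → x ^ k ≈ + 1 [mod m ] → x ^ l ≈ + 1 [mod m ] →
    ∃[ g ] 1 ≤ g × 2 ℕ.* g ≤ l × x ^ g ≈ + 1 [mod m ]
  ≈1-below⇒≈1-half k l 1≤k k<l xᵏ≈1 xˡ≈1 =
    GCD.gcd k l , 1≤gcd , proper-divisor-≤-half (GCD.gcd[m,n]∣n k l) (ℕ.≤-<-trans gcd≤k k<l) , ^-gcd-≈1 k l xᵏ≈1 xˡ≈1
    where
      instance
        k≢0 : NonZero k
        k≢0 = ℕ.>-nonZero 1≤k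
      gcd≤k : GCD.gcd k l ≤ k
      gcd≤k = ℕ∣.∣⇒≤ (GCD.gcd[m,n]∣m k l)
      1≤gcd : 1 ≤ GCD.gcd k l
      1≤gcd = ℕ.n≢0⇒n>0 (λ gcd≡0 → ℕ.<⇒≢ 1≤k (sym (GCD.gcd[m,n]≡0⇒m≡0 gcd≡0)))

  IsOrd-from-halves : ∀ m a l → 1 ≤ l → (+ a) ^ l ≈ + 1 [mod m ] →
    (∀ g → 1 ≤ g → 2 ℕ.* g ≤ l → ¬ ((+ a) ^ g ≈ + 1 [mod m ])) → IsOrd m a l
  IsOrd-from-halves m a l 1≤l aˡ≈1 no-half = 1≤l , ≈⇒≡[mod] aˡ≈1 , below
    where
      below : ∀ j → 1 ≤ j → j < l → ¬ ((+ a) ^ j ≡ + 1 [mod m ])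
      below j 1≤j j<l aʲ≡1 with ≈1-below⇒≈1-half j l 1≤j j<l (≡[mod]⇒≈ aʲ≡1) aˡ≈1
      ... | g , 1≤g , 2g≤l , aᵍ≈1 = no-half g 1≤g 2g≤l aᵍ≈1

module Lifting where

  open import Data.Integer.Base using (_+_; _-_; _*_; _^_)
  open Congruence

  geometric : ℤ → ℕ → ℤ
  geometric y zero    = + 0
  geometric y (suc n) = + 1 + y * geometric y n

  ^-1≡*geometric : ∀ y n → y ^ n - + 1 ≡ (y - + 1) * geometric y n
  ^-1≡*geometric y zero    = sym (ℤ.*-zeroʳ (y - + 1))
  ^-1≡*geometric y (suc n) = begin
    y * y ^ n - + 1                          ≡⟨ split y (y ^ n) ⟩
    y * (y ^ n - + 1) + (y - + 1)            ≡⟨ cong (λ z → y * z + (y - + 1)) (^-1≡*geometric y n) ⟩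
    y * ((y - + 1) * geometric y n) + (y - + 1) ≡⟨ factor y (geometric y n) ⟩
    (y - + 1) * (+ 1 + y * geometric y n)    ∎
    where
      open ≡-Reasoning
      split : ∀ y z → y * z - + 1 ≡ y * (z - + 1) + (y - + 1)
      split = solve-∀
      factor : ∀ y g → y * ((y - + 1) * g) + (y - + 1) ≡ (y - + 1) * (+ 1 + y * g)
      factor = solve-∀

  geometric-≈ : ∀ {m y} n → y ≈ + 1 [mod m ] → geometric y n ≈ + n [mod m ]
  geometric-≈ zero    _   = ≈-refl
  geometric-≈ (suc n) y≈1 =
    ≈-trans (+-cong (≈-refl {x = + 1}) (*-cong y≈1 (geometric-≈ n y≈1)))
            (≈-reflexive (cong (λ z → + 1 + z) (ℤ.*-identityˡ (+ n))))

  -- y^p - 1 = (y - 1)(1 + y + ⋯ + y^(p-1)), and the second factor is ≡ p ≡ 0 (mod p).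
  lift-≈1 : ∀ {p j y} → 1 ≤ j → y ≈ + 1 [mod p ℕ.^ j ] → y ^ p ≈ + 1 [mod p ℕ.^ suc j ]
  lift-≈1 {p} {suc j} {y} _ y≈1 = -≈0⇒≈ (≈-trans (≈-reflexive (^-1≡*geometric y p)) (
      subst (λ m → (y - + 1) * geometric y p ≈ + 0 [mod m ]) (ℕ.*-comm (p ℕ.^ suc j) p)
        (*-pres-≈0 (≈⇒-≈0 y≈1) geometric≈0)))
    where
      geometric≈0 : geometric y p ≈ + 0 [mod p ]
      geometric≈0 = ≈-trans (geometric-≈ p (≈-∣-modulus (ℕ∣.m∣m*n (p ℕ.^ j)) y≈1))
                            (≈-trans (≈-reflexive (sym (ℤ.*-identityˡ (+ p)))) (*-modulus≈0 (+ 1)))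

  lift-≈1-^ : ∀ {p j x} k m → 1 ≤ j → x ^ k ≈ + 1 [mod p ℕ.^ j ] →
    x ^ (k ℕ.* p ℕ.^ m) ≈ + 1 [mod p ℕ.^ (j ℕ.+ m) ]
  lift-≈1-^ {p} {j} {x} k zero    1≤j xᵏ≈1 =
    subst₂ (λ e l → x ^ e ≈ + 1 [mod p ℕ.^ l ]) (sym (ℕ.*-identityʳ k)) (sym (ℕ.+-identityʳ j)) xᵏ≈1
  lift-≈1-^ {p} {j} {x} k (suc m) 1≤j xᵏ≈1 =
    subst₂ (λ z l → z ≈ + 1 [mod p ℕ.^ l ]) ^-p≡ (sym (ℕ.+-suc j m))
      (lift-≈1 (ℕ.≤-trans 1≤j (ℕ.m≤m+n j m)) (lift-≈1-^ k m 1≤j xᵏ≈1))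
    where
      ^-p≡ : (x ^ (k ℕ.* p ℕ.^ m)) ^ p ≡ x ^ (k ℕ.* p ℕ.^ suc m)
      ^-p≡ = trans (ℤ.^-*-assoc x (k ℕ.* p ℕ.^ m) p) (cong (x ^_) (reorder k (p ℕ.^ m) p))
        where reorder : ∀ k a p → k ℕ.* a ℕ.* p ≡ k ℕ.* (p ℕ.* a)
              reorder = ℕ-Solver.solve-∀

module PowersOfNine where

  open import Data.Integer.Base using (_+_; _-_; _*_; _^_)
  open import Defs using (φ)
  open Congruence
  open CoprimeResidues
  open Arithmetic
  open Totient
  open Order
  open Lifting

  9^2^k≈1 : ∀ k → (+ 9) ^ (2 ℕ.^ k) ≈ + 1 [mod 2 ℕ.^ (3 ℕ.+ k) ]
  9^2^k≈1 zero    = ≈-∣-modulus ℕ∣.∣-refl (mk (ℤ∣.divides (+ 1) refl))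
  9^2^k≈1 (suc k) = subst (λ z → z ≈ + 1 [mod 2 ℕ.^ (3 ℕ.+ suc k) ]) squared (lift-≈1 {2} {3 ℕ.+ k} (s≤s z≤n) (9^2^k≈1 k))
    where
      squared : ((+ 9) ^ (2 ℕ.^ k)) ^ 2 ≡ (+ 9) ^ (2 ℕ.^ suc k)
      squared = trans (ℤ.^-*-assoc (+ 9) (2 ℕ.^ k) 2) (cong ((+ 9) ^_) (ℕ.*-comm (2 ℕ.^ k) 2))

  private
    9^odd≈9 : ∀ s → (+ 9) ^ suc (2 ℕ.* s) ≈ + 9 [mod 16 ]
    9^odd≈9 s = begin
      + 9 * (+ 9) ^ (2 ℕ.* s)   ≡⟨ cong (+ 9 *_) (ℤ.^-*-assoc (+ 9) 2 s) ⟨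
      + 9 * ((+ 9) ^ 2) ^ s     ≈⟨ *-congˡ (+ 9) (^-cong s (mk (ℤ∣.divides (+ 5) refl))) ⟩
      + 9 * (+ 1) ^ s           ≡⟨ cong (+ 9 *_) (ℤ.^-zeroˡ s) ⟩
      + 9                       ∎
      where open ≈-Reasoning 16

    9^s≡1+8w : ∀ s → ∃[ w ] (+ 9) ^ s ≡ + 1 + + w * + 8
    9^s≡1+8w zero    = 0 , refl
    9^s≡1+8w (suc s) with 9^s≡1+8w s
    ... | w , 9ˢ≡ = 1 ℕ.+ 9 ℕ.* w , (begin
      + 9 * (+ 9) ^ s                     ≡⟨ cong (+ 9 *_) 9ˢ≡ ⟩
      + 9 * (+ 1 + + w * + 8)             ≡⟨ expand (+ w) ⟩
      + 1 + (+ 1 + + 9 * + w) * + 8       ≡⟨ cong (λ z → + 1 + (+ 1 + z) * + 8) (ℤ.pos-* 9 w) ⟨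
      + 1 + + (1 ℕ.+ 9 ℕ.* w) * + 8       ∎)
      where
        open ≡-Reasoning
        expand : ∀ w → + 9 * (+ 1 + w * + 8) ≡ + 1 + (+ 1 + + 9 * w) * + 8
        expand = solve-∀

  -- 9^s = 1 + 8w gives 9^(2s) - 1 = 2 (1 + 4w) (9^s - 1), and 1 + 4w is odd.
  9^2s≈1⇒9^s≈1 : ∀ k s → (+ 9) ^ (2 ℕ.* s) ≈ + 1 [mod 2 ℕ.^ (4 ℕ.+ k) ] → (+ 9) ^ s ≈ + 1 [mod 2 ℕ.^ (3 ℕ.+ k) ]
  9^2s≈1⇒9^s≈1 k s 9²ˢ≈1 with 9^s≡1+8w s
  ... | w , 9ˢ≡ = -≈0⇒≈ (*-cancelˡ-coprime ((+ 9) ^ s - + 1) (+ 0) o⊥2ᵏ⁺³ o[9ˢ-1]≈0)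
    where
      o : ℕ
      o = suc (2 ℕ.* (2 ℕ.* w))
      o⊥2ᵏ⁺³ : Coprime o (2 ℕ.^ (3 ℕ.+ k))
      o⊥2ᵏ⁺³ = Coprimality.sym (coprime-^ˡ (3 ℕ.+ k) (2⊥odd (2 ℕ.* w)))
      A : ℤ
      A = (+ 9) ^ s
      9²ˢ-1≡ : (+ 9) ^ (2 ℕ.* s) - + 1 ≡ + 2 * (+ o * (A - + 1))
      9²ˢ-1≡ = begin
        (+ 9) ^ (2 ℕ.* s) - + 1                     ≡⟨ cong (λ e → (+ 9) ^ e - + 1) (ℕ.*-comm 2 s) ⟩
        (+ 9) ^ (s ℕ.* 2) - + 1                     ≡⟨ cong (_- + 1) (ℤ.^-*-assoc (+ 9) s 2) ⟨
        A * (A * + 1) - + 1                         ≡⟨ cong (λ x → x * (x * + 1) - + 1) 9ˢ≡ ⟩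
        B * (B * + 1) - + 1                         ≡⟨ factor (+ w) ⟩
        + 2 * ((+ 1 + + 2 * (+ 2 * + w)) * (B - + 1)) ≡⟨ cong₂ (λ x y → + 2 * (x * (y - + 1))) o≡ 9ˢ≡ ⟨
        + 2 * (+ o * (A - + 1))                     ∎
        where
          open ≡-Reasoning
          B : ℤ
          B = + 1 + + w * + 8
          factor : ∀ x → (+ 1 + x * + 8) * ((+ 1 + x * + 8) * + 1) - + 1 ≡ + 2 * ((+ 1 + + 2 * (+ 2 * x)) * ((+ 1 + x * + 8) - + 1))
          factor = solve-∀
          o≡ : + o ≡ + 1 + + 2 * (+ 2 * + w)
          o≡ = trans (ℤ.pos-+ 1 (2 ℕ.* (2 ℕ.* w)))
                 (cong (λ z → + 1 + z) (trans (ℤ.pos-* 2 (2 ℕ.* w)) (cong (+ 2 *_) (ℤ.pos-* 2 w))))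
      o[9ˢ-1]≈0 : + o * ((+ 9) ^ s - + 1) ≈ + o * + 0 [mod 2 ℕ.^ (3 ℕ.+ k) ]
      o[9ˢ-1]≈0 = *-cancel-modulus 2 (subst₂ (_≈_[mod 2 ℕ.^ (4 ℕ.+ k) ]) 9²ˢ-1≡
                    (cong (+ 2 *_) (sym (ℤ.*-zeroʳ (+ o)))) (≈⇒-≈0 9²ˢ≈1))

  9^t≈1⇒2^k∣t : ∀ k t → 1 ≤ t → (+ 9) ^ t ≈ + 1 [mod 2 ℕ.^ (3 ℕ.+ k) ] → 2 ℕ.^ k ℕ∣.∣ t
  9^t≈1⇒2^k∣t zero    t _   _    = ℕ∣.1∣ t
  9^t≈1⇒2^k∣t (suc k) t 1≤t 9ᵗ≈1 with even-or-odd t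
  ... | inj₁ (s , refl) = ℕ∣.*-monoʳ-∣ 2 (9^t≈1⇒2^k∣t k s (2*h≥1⇒h≥1 1≤t) (9^2s≈1⇒9^s≈1 k s 9ᵗ≈1))
  ... | inj₂ (s , refl) = ⊥-elim (from-no (16 ℕ∣.∣? 8) (≈0⇒ℕ∣ (≈⇒-≈0 9≈1)))
    where
      16∣2ᵏ⁺⁴ : 16 ℕ∣.∣ 2 ℕ.^ (4 ℕ.+ k)
      16∣2ᵏ⁺⁴ = subst (16 ℕ∣.∣_) (sym (ℕ.^-distribˡ-+-* 2 4 k)) (ℕ∣.m∣m*n (2 ℕ.^ k))
      9≈1 : + 9 ≈ + 1 [mod 16 ]
      9≈1 = ≈-trans (≈-sym (9^odd≈9 s)) (≈-∣-modulus 16∣2ᵏ⁺⁴ 9ᵗ≈1)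

  9^[2^[b-1]*g]≈1 : ∀ b g → (+ 9) ^ (2 ℕ.^ (b ∸ 1) ℕ.* g) ≈ + 1 [mod 2 ℕ.^ (b ℕ.+ 2) ]
  9^[2^[b-1]*g]≈1 b g = ≈-∣-modulus (^-∣-^ 2 (b+2≤3+[b-1] b)) (^-*-≈1 (2 ℕ.^ (b ∸ 1)) g (9^2^k≈1 (b ∸ 1)))
    where
      b+2≤3+[b-1] : ∀ b → b ℕ.+ 2 ≤ 3 ℕ.+ (b ∸ 1)
      b+2≤3+[b-1] zero    = s≤s (s≤s z≤n)
      b+2≤3+[b-1] (suc b) = ℕ.≤-reflexive (ℕ.+-comm (suc b) 2)

  9^half-φ≈1 : ∀ {m g} → Coprime 3 m → φ m ≡ 2 ℕ.* g → (+ 9) ^ g ≈ + 1 [mod m ]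
  9^half-φ≈1 {m} {g} 3⊥m φ≡2g = subst (_≈ + 1 [mod m ]) 3^φ≡9^g (euler m 3 3⊥m)
    where
      3^φ≡9^g : (+ 3) ^ φ m ≡ (+ 9) ^ g
      3^φ≡9^g = trans (cong ((+ 3) ^_) φ≡2g) (sym (ℤ.^-*-assoc (+ 3) 2 g))


module Bounds where

  open import Data.Nat.Base using (_+_; _*_; _^_; _⊔_)
  open import Data.Sum using (_⊎_)
  open import Data.Nat.Induction using (<-wellFounded)
  open import Data.Nat.Primality.Factorisation using (factorise)
  open import Data.Nat.ListAction using (product)
  open import Data.List.Base using ([]; _∷_)
  open import Data.List.Relation.Unary.All using (_∷_)
  open import Induction.WellFounded using (Acc; acc)
  open import Relation.Nullary using (¬_; yes; no)

  -- The collision u(i + 2t) ≡ u(i) lies within 1, …, n as soon as 2i + 4t ≤ d + 1, because d < 2n.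
  collision-fits : ∀ {n d P Q i t} → 1 ≤ Q → d ≡ P * Q → 2 * i ≤ suc P → 4 * t ≤ P * (Q ∸ 1) →
    d < 2 * n → i + 2 * t ≤ n
  collision-fits {n} {d} {P} {suc Q} {i} {t} _ refl 2i≤P+1 4t≤P*Q d<2n = ℕ.*-cancelˡ-≤ 2 (begin
    2 * (i + 2 * t)          ≡⟨ distribute i t ⟩
    2 * i + 4 * t            ≤⟨ ℕ.+-mono-≤ 2i≤P+1 4t≤P*Q ⟩
    suc P + P * Q            ≡⟨ cong suc (ℕ.*-suc P Q) ⟨
    suc (P * suc Q)          ≤⟨ d<2n ⟩
    2 * n                    ∎)
    where
      open ℕ.≤-Reasoning
      distribute : ∀ i t → 2 * (i + 2 * t) ≡ 2 * i + 4 * t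
      distribute = ℕ-Solver.solve-∀

  2k+1≤3^k : ∀ k → 2 * k + 1 ≤ 3 ^ k
  2k+1≤3^k zero    = ℕ.≤-refl
  2k+1≤3^k (suc k) = begin
    2 * suc k + 1            ≡⟨ step k ⟩
    2 * k + 1 + 2            ≤⟨ ℕ.+-monoʳ-≤ (2 * k + 1) (ℕ.≤-trans (s≤s (s≤s z≤n)) (ℕ.*-monoʳ-≤ 2 (ℕ.m^n>0 3 k))) ⟩
    2 * k + 1 + 2 * 3 ^ k    ≤⟨ ℕ.+-monoˡ-≤ (2 * 3 ^ k) (2k+1≤3^k k) ⟩
    3 ^ k + 2 * 3 ^ k        ≡⟨ triple (3 ^ k) ⟩
    3 ^ suc k                ∎
    where
      open ℕ.≤-Reasoning
      step : ∀ k → 2 * suc k + 1 ≡ 2 * k + 1 + 2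
      step = ℕ-Solver.solve-∀
      triple : ∀ x → x + 2 * x ≡ 3 * x
      triple = ℕ-Solver.solve-∀

  split-power : ∀ p → 2 ≤ p → ∀ s → 1 ≤ s → ∃[ a ] ∃[ r ] s ≡ p ^ a * r × ¬ p ℕ∣.∣ r
  split-power p 2≤p s 1≤s = go s 1≤s (<-wellFounded s)
    where
      go : ∀ s → 1 ≤ s → Acc _<_ s → ∃[ a ] ∃[ r ] s ≡ p ^ a * r × ¬ p ℕ∣.∣ r
      go s 1≤s (acc rec) with p ℕ∣.∣? s
      ... | no p∤s = 0 , s , sym (ℕ.+-identityʳ s) , p∤s
      ... | yes (ℕ∣.divides k s≡k*p) with go k 1≤k (rec k<s)
        where
          1≤k : 1 ≤ k
          1≤k = ℕ.n≢0⇒n>0 (λ { refl → ℕ.<⇒≢ 1≤s (sym s≡k*p) })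
          k<s : k < s
          k<s = subst (k <_) (sym s≡k*p) (ℕ.m<m*n k p {{ℕ.>-nonZero 1≤k}} 2≤p)
      ...   | a , r , k≡pᵃr , p∤r = suc a , r , trans s≡k*p (trans (cong (_* p) k≡pᵃr) (rotate (p ^ a) r p)) , p∤r
        where
          rotate : ∀ x r p → x * r * p ≡ p * x * r
          rotate = ℕ-Solver.solve-∀

  prime-divisor : ∀ s → 2 ≤ s → ∃[ p ] Prime p × p ℕ∣.∣ s
  prime-divisor s@(suc _) 2≤s with factorise s
  ... | record { factors = [] ; isFactorisation = s≡1 } = ⊥-elim (ℕ.<⇒≢ 2≤s (sym s≡1))
  ... | record { factors = p ∷ ps ; isFactorisation = s≡∏ ; factorsPrime = p-prime ∷ _ } =
    p , p-prime , subst (p ℕ∣.∣_) (sym s≡∏) (ℕ∣.m∣m*n (product ps))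

  2*2^[b-1]≤2^b*3^k : ∀ b k → 1 ≤ b ⊎ 1 ≤ k → 2 * 2 ^ (b ∸ 1) ≤ 2 ^ b * 3 ^ k
  2*2^[b-1]≤2^b*3^k (suc b) k _ = ℕ.m≤m*n (2 ^ suc b) (3 ^ k) {{ℕ.>-nonZero (ℕ.m^n>0 3 k)}}
  2*2^[b-1]≤2^b*3^k zero (suc k) _ = ℕ.≤-trans (s≤s (s≤s z≤n))
    (ℕ.≤-trans (ℕ.*-monoʳ-≤ 3 (ℕ.m^n>0 3 k)) (ℕ.≤-reflexive (sym (ℕ.*-identityˡ (3 ^ suc k)))))
  2*2^[b-1]≤2^b*3^k zero zero (inj₁ ())
  2*2^[b-1]≤2^b*3^k zero zero (inj₂ ())

  2*[1+k]≤1+3^k : ∀ k → 2 * suc k ≤ suc (3 ^ k)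
  2*[1+k]≤1+3^k k = subst (_≤ suc (3 ^ k)) (sym (double-suc k)) (s≤s (2k+1≤3^k k))
    where
      double-suc : ∀ k → 2 * suc k ≡ suc (2 * k + 1)
      double-suc = ℕ-Solver.solve-∀

  2*[1⊔c]≤1+3^c : ∀ c → 2 * (1 ⊔ c) ≤ suc (3 ^ c)
  2*[1⊔c]≤1+3^c zero    = ℕ.≤-refl
  2*[1⊔c]≤1+3^c (suc k) = ℕ.≤-trans (2*[1+k]≤1+3^k k) (s≤s (ℕ.m≤n*m (3 ^ k) 3))

  ⌈log₂⌉-bounds : ∀ n → 1 ≤ n → ∃[ e ] n ≤ 2 ^ e × 2 ^ e < 2 * n
  ⌈log₂⌉-bounds (suc zero)    _ = 0 , ℕ.≤-refl , s≤s (s≤s z≤n)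
  ⌈log₂⌉-bounds (suc (suc n)) _ with ⌈log₂⌉-bounds (suc n) (s≤s z≤n)
  ... | e , n+1≤2ᵉ , 2ᵉ<2n+2 with suc (suc n) ℕ.≤? 2 ^ e
  ...   | yes n+2≤2ᵉ = e , n+2≤2ᵉ , ℕ.<-trans 2ᵉ<2n+2 (ℕ.*-monoʳ-< 2 (ℕ.n<1+n (suc n)))
  ...   | no  n+2≰2ᵉ = suc e ,
      subst (suc (suc n) ≤_) (cong (2 *_) n+1≡2ᵉ) (subst (2 + n ≤_) (double n) (ℕ.m≤m+n (2 + n) n)) ,
      subst (_< 2 * suc (suc n)) (cong (2 *_) n+1≡2ᵉ) (ℕ.*-monoʳ-< 2 (ℕ.n<1+n (suc n)))
    where
      n+1≡2ᵉ : suc n ≡ 2 ^ e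
      n+1≡2ᵉ = ℕ.≤-antisym n+1≤2ᵉ (ℕ.≤-pred (ℕ.≰⇒> n+2≰2ᵉ))
      double : ∀ n → 2 + n + n ≡ 2 * suc n
      double = ℕ-Solver.solve-∀

module Sequence (h : ℕ) where

  open import Data.Integer.Base using (-_; _+_; _-_; _*_; _^_)
  import Data.Integer.DivMod as ℤ/
  open import Defs using (qStar; u)
  open Congruence
  open Arithmetic

  q : ℕ
  q = suc (2 ℕ.* h)

  U : ℕ → ℤ
  U j = (+ 3) ^ j - qStar q * ℤ.-1ℤ ^ j

  private
    [x/n]*n≡x : ∀ n .{{_ : NonZero n}} x → x ≈ + 0 [mod n ] → (x ℤ./ + n) * + n ≡ x
    [x/n]*n≡x n x x≈0 = begin
      (x ℤ./ + n) * + n                      ≡⟨ ℤ.+-identityˡ _ ⟨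
      + 0 + (x ℤ./ + n) * + n                ≡⟨ cong (λ r → + r + (x ℤ./ + n) * + n) r≡0 ⟨
      + (x ℤ.% + n) + (x ℤ./ + n) * + n      ≡⟨ ℤ/.a≡a%n+[a/n]*n x (+ n) ⟨
      x                                      ∎
      where
        open ≡-Reasoning
        x-[x/n]*n≡ : x - (x ℤ./ + n) * + n ≡ + (x ℤ.% + n)
        x-[x/n]*n≡ = trans (cong (_- (x ℤ./ + n) * + n) (ℤ/.a≡a%n+[a/n]*n x (+ n))) (cancel (+ (x ℤ.% + n)) ((x ℤ./ + n) * + n))
          where cancel : ∀ a b → (a + b) - b ≡ a
                cancel = solve-∀
        r≡0 : x ℤ.% + n ≡ 0
        r≡0 = ∣∧<⇒≡0 (≈0⇒ℕ∣ (subst (_≈ + 0 [mod n ]) x-[x/n]*n≡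
                (-cong x≈0 (*-modulus≈0 (x ℤ./ + n))))) (ℤ/.n%d<d x (+ n))

  q*≈1 : qStar q ≈ + 1 [mod 4 ]
  q*≈1 with even-or-odd h
  ... | inj₁ (r , refl) = begin
    qStar q                            ≡⟨ cong (λ e → ℤ.-1ℤ ^ e * + q) (half-double h) ⟩
    ℤ.-1ℤ ^ (2 ℕ.* r) * + q            ≡⟨ cong (_* + q) (-1ℤ^even r) ⟩
    + 1 * + q                          ≡⟨ ℤ.*-identityˡ (+ q) ⟩
    + q                                ≈⟨ ∣∸⇒≈ (s≤s z≤n) (ℕ∣.divides r (four r)) ⟩
    + 1                                ∎
    where
      open ≈-Reasoning 4
      four : ∀ r → 2 ℕ.* (2 ℕ.* r) ≡ r ℕ.* 4
      four = ℕ-Solver.solve-∀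
  ... | inj₂ (r , refl) = begin
    qStar q                            ≡⟨ cong (λ e → ℤ.-1ℤ ^ e * + q) (half-double h) ⟩
    ℤ.-1ℤ ^ suc (2 ℕ.* r) * + q        ≡⟨ cong (_* + q) (-1ℤ^odd r) ⟩
    ℤ.-1ℤ * + q                        ≈⟨ *-congˡ ℤ.-1ℤ q≈-1 ⟩
    + 1                                ∎
    where
      open ≈-Reasoning 4
      q≡3+4r : ∀ r → suc (2 ℕ.* suc (2 ℕ.* r)) ≡ 3 ℕ.+ r ℕ.* 4
      q≡3+4r = ℕ-Solver.solve-∀
      q≈-1 : + q ≈ ℤ.-1ℤ [mod 4 ]
      q≈-1 = ≈-trans (∣∸⇒≈ (subst (3 ≤_) (sym (q≡3+4r r)) (ℕ.m≤m+n 3 (r ℕ.* 4)))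
                       (ℕ∣.divides r (trans (cong (_∸ 3) (q≡3+4r r)) (ℕ.m+n∸m≡n 3 (r ℕ.* 4)))))
                     (mk (ℤ∣.divides (+ 1) refl))

  U≈0 : ∀ j → U j ≈ + 0 [mod 4 ]
  U≈0 j = begin
    (+ 3) ^ j - qStar q * ℤ.-1ℤ ^ j     ≈⟨ -cong (^-cong j (mk (ℤ∣.divides (+ 1) refl))) (*-congʳ (ℤ.-1ℤ ^ j) q*≈1) ⟩
    ℤ.-1ℤ ^ j - + 1 * ℤ.-1ℤ ^ j         ≡⟨ cancel (ℤ.-1ℤ ^ j) ⟩
    + 0                                 ∎
    where
      open ≈-Reasoning 4
      cancel : ∀ x → x - + 1 * x ≡ + 0
      cancel = solve-∀

  4u≡U : ∀ j → + 4 * u q j ≡ U j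
  4u≡U j = trans (ℤ.*-comm (+ 4) (u q j)) ([x/n]*n≡x 4 (U j) (U≈0 j))

  u≈⇒U≈ : ∀ {m i j} → u q i ≈ u q j [mod m ] → U i ≈ U j [mod 4 ℕ.* m ]
  u≈⇒U≈ {i = i} {j} p = subst₂ (_≈_[mod _ ]) (4u≡U i) (4u≡U j) (*-cong-modulus 4 p)

  U≈⇒u≈ : ∀ {m i j} → U i ≈ U j [mod 4 ℕ.* m ] → u q i ≈ u q j [mod m ]
  U≈⇒u≈ {i = i} {j} p = *-cancel-modulus 4 (subst₂ (_≈_[mod _ ]) (sym (4u≡U i)) (sym (4u≡U j)) p)

  U[i+2t]-U[i]≡ : ∀ i t → U (i ℕ.+ 2 ℕ.* t) - U i ≡ (+ 3) ^ i * ((+ 9) ^ t - + 1)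
  U[i+2t]-U[i]≡ i t = begin
    (+ 3) ^ (i ℕ.+ 2 ℕ.* t) - qStar q * ℤ.-1ℤ ^ (i ℕ.+ 2 ℕ.* t) - U i
      ≡⟨ cong₂ (λ a b → a - qStar q * b - U i) (ℤ.^-distribˡ-+-* (+ 3) i (2 ℕ.* t))
               (trans (ℤ.^-distribˡ-+-* ℤ.-1ℤ i (2 ℕ.* t)) (cong (ℤ.-1ℤ ^ i *_) (-1ℤ^even t))) ⟩
    (+ 3) ^ i * (+ 3) ^ (2 ℕ.* t) - qStar q * (ℤ.-1ℤ ^ i * + 1) - U i
      ≡⟨ factor ((+ 3) ^ i) ((+ 3) ^ (2 ℕ.* t)) (qStar q) (ℤ.-1ℤ ^ i) ⟩
    (+ 3) ^ i * ((+ 3) ^ (2 ℕ.* t) - + 1)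
      ≡⟨ cong (λ z → (+ 3) ^ i * (z - + 1)) (ℤ.^-*-assoc (+ 3) 2 t) ⟨
    (+ 3) ^ i * ((+ 9) ^ t - + 1)        ∎
    where
      open ≡-Reasoning
      factor : ∀ a b c d → a * b - c * (d * + 1) - (a - c * d) ≡ a * (b - + 1)
      factor = solve-∀

  -- U(j+1) - U(j) = 2 (3^j + q* (-1)^j), and 3^j + q* (-1)^j ≡ 2 (mod 4).
  u-suc≈ : ∀ j → u q (suc j) ≈ u q j + + 1 [mod 2 ]
  u-suc≈ j = -≈⇒≈+ (*-cancel-modulus 4 {2} {u q (suc j) - u q j} {+ 1}
               (subst (_≈ + 4 [mod 8 ]) U-step (*-cong-modulus 2 sum≈2)))
    where
      sum≈2 : (+ 3) ^ j + qStar q * ℤ.-1ℤ ^ j ≈ + 2 [mod 4 ]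
      sum≈2 = ≈-trans (+-cong (^-cong j (mk (ℤ∣.divides (+ 1) refl))) (*-congʳ (ℤ.-1ℤ ^ j) q*≈1)) (twice j)
        where
          twice : ∀ j → ℤ.-1ℤ ^ j + + 1 * ℤ.-1ℤ ^ j ≈ + 2 [mod 4 ]
          twice j with even-or-odd j
          ... | inj₁ (r , refl) = ≈-reflexive (cong (λ z → z + + 1 * z) (-1ℤ^even r))
          ... | inj₂ (r , refl) = ≈-trans (≈-reflexive (cong (λ z → z + + 1 * z) (-1ℤ^odd r))) (mk (ℤ∣.divides (- + 1) refl))
      U-step : + 2 * ((+ 3) ^ j + qStar q * ℤ.-1ℤ ^ j) ≡ + 4 * (u q (suc j) - u q j)
      U-step = begin
        + 2 * ((+ 3) ^ j + qStar q * ℤ.-1ℤ ^ j)   ≡⟨ step ((+ 3) ^ j) (qStar q) (ℤ.-1ℤ ^ j) ⟨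
        U (suc j) - U j                           ≡⟨ cong₂ _-_ (4u≡U (suc j)) (4u≡U j) ⟨
        + 4 * u q (suc j) - + 4 * u q j           ≡⟨ factor (u q (suc j)) (u q j) ⟩
        + 4 * (u q (suc j) - u q j)               ∎
        where
          open ≡-Reasoning
          factor : ∀ x y → + 4 * x - + 4 * y ≡ + 4 * (x - y)
          factor = solve-∀
          step : ∀ a c d → + 3 * a - c * (ℤ.-1ℤ * d) - (a - c * d) ≡ + 2 * (a + c * d)
          step = solve-∀

  u-+≈ : ∀ i d → u q (i ℕ.+ d) ≈ u q i + + d [mod 2 ]
  u-+≈ i zero    = ≈-reflexive (trans (cong (u q) (ℕ.+-identityʳ i)) (sym (ℤ.+-identityʳ (u q i))))
  u-+≈ i (suc d) = begin
    u q (i ℕ.+ suc d)        ≡⟨ cong (u q) (ℕ.+-suc i d) ⟩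
    u q (suc (i ℕ.+ d))      ≈⟨ u-suc≈ (i ℕ.+ d) ⟩
    u q (i ℕ.+ d) + + 1      ≈⟨ +-cong (u-+≈ i d) ≈-refl ⟩
    u q i + + d + + 1        ≡⟨ ℤ.+-assoc (u q i) (+ d) (+ 1) ⟩
    u q i + (+ d + + 1)      ≡⟨ cong (λ z → u q i + z) (ℤ.+-comm (+ d) (+ 1)) ⟩
    u q i + + suc d          ∎
    where open ≈-Reasoning 2

  U≈3^ : ∀ j → U j ≈ (+ 3) ^ j [mod q ]
  U≈3^ j = begin
    (+ 3) ^ j - qStar q * ℤ.-1ℤ ^ j     ≈⟨ -cong (≈-refl {x = (+ 3) ^ j}) (*-congʳ (ℤ.-1ℤ ^ j) q*≈0) ⟩
    (+ 3) ^ j - + 0 * ℤ.-1ℤ ^ j         ≡⟨ drop ((+ 3) ^ j) (ℤ.-1ℤ ^ j) ⟩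
    (+ 3) ^ j                           ∎
    where
      open ≈-Reasoning q
      q*≈0 : qStar q ≈ + 0 [mod q ]
      q*≈0 = *-modulus≈0 (ℤ.-1ℤ ^ ((q ∸ 1) ℕ./ 2))
      drop : ∀ a b → a - + 0 * b ≡ a
      drop = solve-∀

module Collisions (h : ℕ) where

  open import Data.Nat.Base using (_^_; _*_; _+_)
  open import Relation.Binary.Definitions using (tri<; tri≈; tri>)
  open import Relation.Nullary using (¬_; yes; no)
  open import Defs using (u; PairwiseIncongruent; IsD)
  open Congruence
  open CoprimeResidues
  open Arithmetic
  open PowersOfNine
  open Bounds
  open Sequence h

  collision : ∀ {n m i j} → PairwiseIncongruent q n m → 1 ≤ i → i ≤ n → 1 ≤ j → j ≤ n → i ≢ j →
    ¬ (u q i ≈ u q j [mod m ])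
  collision incongruent 1≤i i≤n 1≤j j≤n i≢j uᵢ≈uⱼ = incongruent _ _ 1≤i i≤n 1≤j j≤n i≢j (≈⇒≡[mod] uᵢ≈uⱼ)

  no-collision-gap : ∀ {n m i t} → PairwiseIncongruent q n m → 1 ≤ i → 1 ≤ t → i + 2 * t ≤ n →
    ¬ ((+ 3) ℤ.^ i ℤ.* ((+ 9) ℤ.^ t ℤ.- + 1) ≈ + 0 [mod 4 * m ])
  no-collision-gap {i = i} {t} incongruent 1≤i 1≤t i+2t≤n 4m∣ =
    collision incongruent (ℕ.≤-trans 1≤i (ℕ.m≤m+n i _)) i+2t≤n 1≤i (ℕ.≤-trans (ℕ.m≤m+n i _) i+2t≤n) i+2t≢i
      (U≈⇒u≈ {i = i + 2 * t} {i} (-≈0⇒≈ (subst (_≈ + 0 [mod _ ]) (sym (U[i+2t]-U[i]≡ i t)) 4m∣)))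
    where
      i+2t≢i : i + 2 * t ≢ i
      i+2t≢i eq = ℕ.<-irrefl (sym eq) (ℕ.m<m+n i (ℕ.≤-trans 1≤t (ℕ.m≤m+n t _)))

  no-collision-mod-q : ∀ {n k} → PairwiseIncongruent q n q → 1 ≤ k → suc k ≤ n → ¬ ((+ 3) ℤ.^ k ≈ + 1 [mod q ])
  no-collision-mod-q {n} {k} incongruent 1≤k k+1≤n 3ᵏ≈1 =
    collision incongruent (s≤s z≤n) k+1≤n (s≤s z≤n) (ℕ.≤-trans (s≤s z≤n) k+1≤n) (λ { refl → ℕ.<-irrefl refl 1≤k })
      (*-cancelˡ-coprime (u q (suc k)) (u q 1) (coprime-*ˡ (2⊥odd h) (2⊥odd h)) 4u≈4u)
    where
      4u≈4u : + 4 ℤ.* u q (suc k) ≈ + 4 ℤ.* u q 1 [mod q ]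
      4u≈4u = begin
        + 4 ℤ.* u q (suc k)      ≡⟨ 4u≡U (suc k) ⟩
        U (suc k)                ≈⟨ U≈3^ (suc k) ⟩
        + 3 ℤ.* (+ 3) ℤ.^ k      ≈⟨ *-congˡ (+ 3) 3ᵏ≈1 ⟩
        + 3                      ≈⟨ U≈3^ 1 ⟨
        U 1                      ≡⟨ 4u≡U 1 ⟨
        + 4 ℤ.* u q 1            ∎
        where open ≈-Reasoning q

  private
    3^i*x≈0⇒x≈0 : ∀ {k} i x → (+ 3) ℤ.^ i ℤ.* x ≈ + 0 [mod 2 ^ k ] → x ≈ + 0 [mod 2 ^ k ]
    3^i*x≈0⇒x≈0 {k} i x 3ⁱx≈0 = *-cancelˡ-coprime x (+ 0) 3ⁱ⊥2ᵏ
      (≈-trans (≈-reflexive (cong (ℤ._* x) (pos-^ 3 i))) (≈-trans 3ⁱx≈0 (≈-reflexive (sym (ℤ.*-zeroʳ (+ (3 ^ i)))))))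
      where
        3ⁱ⊥2ᵏ : Coprime (3 ^ i) (2 ^ k)
        3ⁱ⊥2ᵏ = coprime-^ˡ i (Coprimality.sym (coprime-^ˡ k (2⊥odd 1)))

    -- An odd gap changes the parity of u; an even gap 2t forces 2^(e+3) ∣ 9^t - 1, hence 2^e ∣ t.
    no-collision-2^e : ∀ e i j → 1 ≤ i → i < j → j ≤ 2 ^ e → ¬ (u q i ≈ u q j [mod 2 ^ e ])
    no-collision-2^e zero    i j 1≤i i<j j≤1 _ = ℕ.<⇒≱ (ℕ.≤-<-trans 1≤i i<j) j≤1
    no-collision-2^e (suc e) i j 1≤i i<j j≤2ᵉ⁺¹ uᵢ≈uⱼ with even-or-odd (j ∸ i)
    ... | inj₂ (w , j∸i≡2w+1) = from-no (2 ℕ∣.∣? 1) (≈0⇒ℕ∣ (≈-sym 0≈1))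
      where
        j∸i≈1 : + (j ∸ i) ≈ + 1 [mod 2 ]
        j∸i≈1 = subst (λ z → + z ≈ + 1 [mod 2 ]) (sym j∸i≡2w+1) (∣∸⇒≈ (s≤s z≤n) (ℕ∣.m∣m*n w))
        uᵢ≈uᵢ+1 : u q i ≈ u q i ℤ.+ + 1 [mod 2 ]
        uᵢ≈uᵢ+1 = begin
          u q i                      ≈⟨ ≈-∣-modulus (ℕ∣.m∣m*n (2 ^ e)) uᵢ≈uⱼ ⟩
          u q j                      ≡⟨ cong (u q) (ℕ.m+[n∸m]≡n (ℕ.<⇒≤ i<j)) ⟨
          u q (i + (j ∸ i))          ≈⟨ u-+≈ i (j ∸ i) ⟩
          u q i ℤ.+ + (j ∸ i)        ≈⟨ +-cong (≈-refl {x = u q i}) j∸i≈1 ⟩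
          u q i ℤ.+ + 1              ∎
          where open ≈-Reasoning 2
        0≈1 : + 0 ≈ + 1 [mod 2 ]
        0≈1 = ≈-trans (≈-reflexive (sym (ℤ.+-inverseʳ (u q i)))) (≈+⇒-≈ uᵢ≈uᵢ+1)
    ... | inj₁ (t , j∸i≡2t) = ℕ.<⇒≱ 2t<2ᵉ⁺¹ (ℕ.*-monoʳ-≤ 2 (ℕ∣.∣⇒≤ {{ℕ.>-nonZero 1≤t}} 2ᵉ∣t))
      where
        j≡i+2t : j ≡ i + 2 * t
        j≡i+2t = trans (sym (ℕ.m+[n∸m]≡n (ℕ.<⇒≤ i<j))) (cong (λ x → i + x) j∸i≡2t)
        1≤t : 1 ≤ t
        1≤t = 2*h≥1⇒h≥1 (subst (1 ≤_) j∸i≡2t (ℕ.m<n⇒0<n∸m i<j))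
        2t<2ᵉ⁺¹ : 2 * t < 2 ^ suc e
        2t<2ᵉ⁺¹ = ℕ.<-≤-trans (subst (2 * t <_) (sym j≡i+2t) (ℕ.m<n+m (2 * t) 1≤i)) j≤2ᵉ⁺¹
        U≈U : U (i + 2 * t) ≈ U i [mod 2 ^ (3 + e) ]
        U≈U = subst₂ (λ k m → U k ≈ U i [mod m ]) j≡i+2t (four e) (u≈⇒U≈ {2 ^ suc e} {j} {i} (≈-sym uᵢ≈uⱼ))
          where
            four : ∀ e → 4 * 2 ^ suc e ≡ 2 ^ (3 + e)
            four e = doubling (2 ^ e)
              where doubling : ∀ x → 4 * (2 * x) ≡ 2 * (2 * (2 * x))
                    doubling = ℕ-Solver.solve-∀
        9ᵗ≈1 : (+ 9) ℤ.^ t ≈ + 1 [mod 2 ^ (3 + e) ]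
        9ᵗ≈1 = -≈0⇒≈ (3^i*x≈0⇒x≈0 {3 + e} i ((+ 9) ℤ.^ t ℤ.- + 1)
                 (subst (_≈ + 0 [mod _ ]) (U[i+2t]-U[i]≡ i t) (≈⇒-≈0 U≈U)))
        2ᵉ∣t : 2 ^ e ℕ∣.∣ t
        2ᵉ∣t = 9^t≈1⇒2^k∣t e t 1≤t 9ᵗ≈1

  incongruent-mod-2^e : ∀ e n → n ≤ 2 ^ e → PairwiseIncongruent q n (2 ^ e)
  incongruent-mod-2^e e n n≤2ᵉ i j 1≤i i≤n 1≤j j≤n i≢j uᵢ≡uⱼ with ℕ.<-cmp i j
  ... | tri< i<j _ _ = no-collision-2^e e i j 1≤i i<j (ℕ.≤-trans j≤n n≤2ᵉ) (≡[mod]⇒≈ uᵢ≡uⱼ)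
  ... | tri≈ _ i≡j _ = i≢j i≡j
  ... | tri> _ _ j<i = no-collision-2^e e j i 1≤j j<i (ℕ.≤-trans i≤n n≤2ᵉ) (≈-sym (≡[mod]⇒≈ uᵢ≡uⱼ))

  D<2n : ∀ {n d} → 1 ≤ n → IsD q n d → d < 2 * n
  D<2n {n} {d} 1≤n (_ , _ , minimal) with ⌈log₂⌉-bounds n 1≤n
  ... | e , n≤2ᵉ , 2ᵉ<2n with d ℕ.≤? 2 ^ e
  ...   | yes d≤2ᵉ = ℕ.≤-<-trans d≤2ᵉ 2ᵉ<2n
  ...   | no  d≰2ᵉ = ⊥-elim (minimal (2 ^ e) (ℕ.m^n>0 2 e) (ℕ.≰⇒> d≰2ᵉ) (incongruent-mod-2^e e n n≤2ᵉ))

  no-collision-factored : ∀ {n d c M i t} → PairwiseIncongruent q n d → 4 * d ≡ 3 ^ c * M →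
    c ≤ i → 1 ≤ i → 1 ≤ t → i + 2 * t ≤ n → ¬ ((+ 9) ℤ.^ t ≈ + 1 [mod M ])
  no-collision-factored {c = c} {M} {i} {t} incongruent 4d≡3ᶜM c≤i 1≤i 1≤t i+2t≤n 9ᵗ≈1 =
    no-collision-gap incongruent 1≤i 1≤t i+2t≤n
      (subst (λ m → (+ 3) ℤ.^ i ℤ.* ((+ 9) ℤ.^ t ℤ.- + 1) ≈ + 0 [mod m ]) (sym 4d≡3ᶜM)
        (*-pres-≈0 3ⁱ≈0 (≈⇒-≈0 9ᵗ≈1)))
    where
      3ⁱ≈0 : (+ 3) ℤ.^ i ≈ + 0 [mod 3 ^ c ]
      3ⁱ≈0 = subst (_≈ + 0 [mod 3 ^ c ]) (pos-^ 3 i) (ℕ∣⇒≈0 (^-∣-^ 3 c≤i))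

  9^k≈1⇒n≤2k : ∀ {n m k} → PairwiseIncongruent q n m → Coprime 2 m → 1 ≤ k →
    (+ 9) ℤ.^ k ≈ + 1 [mod m ] → n ≤ 2 * k
  9^k≈1⇒n≤2k {n} {m} {k} incongruent 2⊥m 1≤k 9ᵏ≈1 with suc (2 * k) ℕ.≤? n
  ... | no  2k+1≰n = ℕ.≤-pred (ℕ.≰⇒> 2k+1≰n)
  ... | yes 2k+1≤n = ⊥-elim (no-collision-factored {c = 0} incongruent (sym (ℕ.*-identityˡ (4 * m)))
                       z≤n ℕ.≤-refl 1≤k 2k+1≤n (≈1-coprime-* (coprime-^ˡ 2 2⊥m) 9ᵏ≈1[4] 9ᵏ≈1))
    where
      9ᵏ≈1[4] : (+ 9) ℤ.^ k ≈ + 1 [mod 4 ]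
      9ᵏ≈1[4] = subst (λ e → (+ 9) ℤ.^ e ≈ + 1 [mod 4 ]) (ℕ.*-identityˡ k) (9^[2^[b-1]*g]≈1 0 k)

  3^k≈1⇒n≤k : ∀ {n k} → PairwiseIncongruent q n q → 1 ≤ k → (+ 3) ℤ.^ k ≈ + 1 [mod q ] → n ≤ k
  3^k≈1⇒n≤k {n} {k} incongruent 1≤k 3ᵏ≈1 with suc k ℕ.≤? n
  ... | no  k+1≰n = ℕ.≤-pred (ℕ.≰⇒> k+1≰n)
  ... | yes k+1≤n = ⊥-elim (no-collision-mod-q incongruent 1≤k k+1≤n 3ᵏ≈1)


module PrimePowerModulus (h : ℕ) {n hp a₀ : ℕ} (p-prime : Prime (suc (2 ℕ.* hp))) (5≤p : 5 ≤ suc (2 ℕ.* hp))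
    (1≤n : 1 ≤ n) (D : Defs.IsD (suc (2 ℕ.* h)) n (suc (2 ℕ.* hp) ℕ.^ suc a₀)) where

  -- Each claim is by contradiction: an exponent k ≥ 1 below the claimed order gives a collision
  -- among u(1), …, u(n) unless n ≤ 2k (n ≤ k for powers of 3 modulo q), and then 2n ≤ p^a.

  open import Data.Nat.Base using (_^_; _*_; _+_; _/_)
  open import Relation.Nullary using (¬_)
  open import Defs using (φ; IsOrd; _≡_[mod_])
  open Congruence
  open CoprimeResidues
  open Arithmetic
  open Totient
  open Order
  open Lifting
  open PowersOfNine
  open Sequence h using (q)
  open Collisions h

  p a : ℕ
  p = suc (2 * hp)
  a = suc a₀

  private
    incongruent : Defs.PairwiseIncongruent q n (p ^ a)
    incongruent = proj₁ (proj₂ D)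

    2n≰pᵃ : ¬ (2 * n ≤ p ^ a)
    2n≰pᵃ = ℕ.<⇒≱ (D<2n 1≤n D)

    2⊥p^ : ∀ k → Coprime 2 (p ^ k)
    2⊥p^ k = Coprimality.sym (coprime-^ˡ k (Coprimality.sym (2⊥odd hp)))

    3⊥p^ : ∀ k → Coprime 3 (p ^ k)
    3⊥p^ k = Coprimality.sym (coprime-^ˡ k (Coprimality.prime⇒coprime p-prime (ℕ.≤-trans (ℕ.n≤1+n 4) 5≤p)))

    n≤2k : ∀ {k} → 1 ≤ k → (+ 9) ℤ.^ k ≈ + 1 [mod p ^ a ] → n ≤ 2 * k
    n≤2k = 9^k≈1⇒n≤2k incongruent (2⊥p^ a)

    1≤hp : 1 ≤ hp
    1≤hp = 2*h≥1⇒h≥1 (ℕ.≤-pred (ℕ.≤-trans (s≤s (s≤s z≤n)) 5≤p))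

    pᵏ≢0 : ∀ k → NonZero (p ^ k)
    pᵏ≢0 k = ℕ.>-nonZero (ℕ.m^n>0 p k)

    ≈[mod-p]⇒≈[mod-p¹] : ∀ {x y} → x ≈ y [mod p ] → x ≈ y [mod p ^ 1 ]
    ≈[mod-p]⇒≈[mod-p¹] {x} {y} = subst (λ m → x ≈ y [mod m ]) (sym (ℕ.*-identityʳ p))

  IsOrd-9-pᵃ : IsOrd (p ^ a) 9 (φ (p ^ a) / 2)
  IsOrd-9-pᵃ with half-totient (p ^ a) (ℕ.≤-trans (ℕ.≤-trans (ℕ.m≤n+m 3 2) 5≤p) (ℕ.m≤m*n p (p ^ a₀) {{pᵏ≢0 a₀}}))
  ... | G , φ≡2G , 1≤G , 2G<pᵃ =
    subst (IsOrd (p ^ a) 9) (sym (trans (cong (_/ 2) φ≡2G) (half-double G)))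
      (IsOrd-from-halves (p ^ a) 9 G 1≤G (9^half-φ≈1 {g = G} (3⊥p^ a) φ≡2G) no-half)
    where
      no-half : ∀ g → 1 ≤ g → 2 * g ≤ G → ¬ ((+ 9) ℤ.^ g ≈ + 1 [mod p ^ a ])
      no-half g 1≤g 2g≤G 9ᵍ≈1 = 2n≰pᵃ (begin
        2 * n          ≤⟨ ℕ.*-monoʳ-≤ 2 (n≤2k 1≤g 9ᵍ≈1) ⟩
        2 * (2 * g)    ≤⟨ ℕ.*-monoʳ-≤ 2 2g≤G ⟩
        2 * G          ≤⟨ ℕ.<⇒≤ 2G<pᵃ ⟩
        p ^ a          ∎)
        where open ℕ.≤-Reasoning

  -- A smaller order of 9 modulo p lifts to a smaller order modulo p^a, by a factor p^(a-1).
  IsOrd-9-p : IsOrd p 9 ((p ∸ 1) / 2)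
  IsOrd-9-p = subst (IsOrd p 9) (sym (half-double hp))
    (IsOrd-from-halves p 9 hp 1≤hp (9^half-φ≈1 {g = hp} (subst (Coprime 3) (ℕ.*-identityʳ p) (3⊥p^ 1)) (φ-prime p-prime)) no-half)
    where
      no-half : ∀ g → 1 ≤ g → 2 * g ≤ hp → ¬ ((+ 9) ℤ.^ g ≈ + 1 [mod p ])
      no-half g 1≤g 2g≤hp 9ᵍ≈1 = 2n≰pᵃ (begin
        2 * n                    ≤⟨ ℕ.*-monoʳ-≤ 2 (n≤2k (ℕ.*-mono-≤ 1≤g (ℕ.m^n>0 p a₀)) 9^[g*pᵃ⁻¹]≈1) ⟩
        2 * (2 * (g * p ^ a₀))   ≡⟨ reassociate g (p ^ a₀) ⟩
        2 * (2 * g) * p ^ a₀     ≤⟨ ℕ.*-monoˡ-≤ (p ^ a₀) (ℕ.*-monoʳ-≤ 2 2g≤hp) ⟩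
        2 * hp * p ^ a₀          ≤⟨ ℕ.m≤n+m (2 * hp * p ^ a₀) (p ^ a₀) ⟩
        p ^ a                    ∎)
        where
          open ℕ.≤-Reasoning
          reassociate : ∀ g x → 2 * (2 * (g * x)) ≡ 2 * (2 * g) * x
          reassociate = ℕ-Solver.solve-∀
          9^[g*pᵃ⁻¹]≈1 : (+ 9) ℤ.^ (g * p ^ a₀) ≈ + 1 [mod p ^ a ]
          9^[g*pᵃ⁻¹]≈1 = lift-≈1-^ {p} {1} g a₀ (s≤s z≤n) (≈[mod-p]⇒≈[mod-p¹] 9ᵍ≈1)

  non-Wieferich : 2 ≤ a → ¬ ((+ 3) ℤ.^ (p ∸ 1) ≡ + 1 [mod p ^ 2 ])
  non-Wieferich (s≤s 1≤a₀) 3ᵖ⁻¹≡1 = 2n≰pᵃ (begin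
    2 * n                     ≤⟨ ℕ.*-monoʳ-≤ 2 (n≤2k (ℕ.*-mono-≤ 1≤hp (ℕ.m^n>0 p a₁)) 9^[hp*pᵃ⁻²]≈1) ⟩
    2 * (2 * (hp * p ^ a₁))   ≡⟨ reassociate hp (p ^ a₁) ⟩
    2 * hp * (2 * p ^ a₁)     <⟨ ℕ.*-monoˡ-< (2 * p ^ a₁) {{ℕ.m*n≢0 2 (p ^ a₁) {{_}} {{pᵏ≢0 a₁}}}} (ℕ.n<1+n (2 * hp)) ⟩
    p * (2 * p ^ a₁)          ≤⟨ ℕ.*-monoʳ-≤ p (ℕ.*-monoˡ-≤ (p ^ a₁) (ℕ.≤-trans (ℕ.m≤n+m 2 3) 5≤p)) ⟩
    p * (p * p ^ a₁)          ≡⟨ cong (p ^_) (cong suc a₀≡1+a₁) ⟨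
    p ^ a                     ∎)
    where
      open ℕ.≤-Reasoning
      a₁ : ℕ
      a₁ = a₀ ∸ 1
      a₀≡1+a₁ : a₀ ≡ suc a₁
      a₀≡1+a₁ = sym (ℕ.suc-pred a₀ {{ℕ.>-nonZero 1≤a₀}})
      reassociate : ∀ h x → 2 * (2 * (h * x)) ≡ 2 * h * (2 * x)
      reassociate = ℕ-Solver.solve-∀
      9ʰᵖ≈1 : (+ 9) ℤ.^ hp ≈ + 1 [mod p ^ 2 ]
      9ʰᵖ≈1 = subst (_≈ + 1 [mod p ^ 2 ]) (sym (ℤ.^-*-assoc (+ 3) 2 hp)) (≡[mod]⇒≈ 3ᵖ⁻¹≡1)
      9^[hp*pᵃ⁻²]≈1 : (+ 9) ℤ.^ (hp * p ^ a₁) ≈ + 1 [mod p ^ a ]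
      9^[hp*pᵃ⁻²]≈1 = subst (λ m → (+ 9) ℤ.^ (hp * p ^ a₁) ≈ + 1 [mod p ^ m ]) (cong suc (sym a₀≡1+a₁))
                        (lift-≈1-^ {p} {2} hp a₁ (s≤s z≤n) 9ʰᵖ≈1)

  IsOrd-3-q : Prime q → p ^ a ≡ q → IsOrd q 3 (q ∸ 1)
  IsOrd-3-q q-prime pᵃ≡q = IsOrd-from-halves q 3 (2 * h) (ℕ.≤-pred (prime⇒≥2 q-prime)) 3²ʰ≈1 no-half
    where
      3²ʰ≈1 : (+ 3) ℤ.^ (2 * h) ≈ + 1 [mod q ]
      3²ʰ≈1 = subst (λ e → (+ 3) ℤ.^ e ≈ + 1 [mod q ]) (φ-prime q-prime) (euler q 3 (subst (Coprime 3) pᵃ≡q (3⊥p^ a)))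
      no-half : ∀ g → 1 ≤ g → 2 * g ≤ 2 * h → ¬ ((+ 3) ℤ.^ g ≈ + 1 [mod q ])
      no-half g 1≤g 2g≤2h 3ᵍ≈1 = 2n≰pᵃ (begin
        2 * n      ≤⟨ ℕ.*-monoʳ-≤ 2 (3^k≈1⇒n≤k (subst (Defs.PairwiseIncongruent q n) pᵃ≡q incongruent) 1≤g 3ᵍ≈1) ⟩
        2 * g      ≤⟨ 2g≤2h ⟩
        2 * h      ≤⟨ ℕ.n≤1+n (2 * h) ⟩
        q          ≡⟨ pᵃ≡q ⟨
        p ^ a      ∎)
        where open ℕ.≤-Reasoning

module Classification (h : ℕ) {n d : ℕ} (1≤n : 1 ≤ n) (D : Defs.IsD (suc (2 ℕ.* h)) n d) where

  open import Data.Nat.Base using (_+_; _*_; _^_; _⊔_)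
  open import Data.Sum using (_⊎_)
  open import Relation.Nullary using (¬_; yes; no)
  open import Defs using (PairwiseIncongruent)
  open Congruence
  open CoprimeResidues
  open Arithmetic
  open Order
  open Totient using (half-totient)
  open PowersOfNine
  open Bounds
  open Sequence h using (q)
  open Collisions h

  private
    incongruent : PairwiseIncongruent q n d
    incongruent = proj₁ (proj₂ D)

    d<2n : d < 2 * n
    d<2n = D<2n 1≤n D

  D≢3 : d ≢ 3
  D≢3 refl with 3 ℕ.≤? n
  ... | yes 3≤n = no-collision-factored {c = 1} {M = 4} incongruent refl ℕ.≤-refl ℕ.≤-refl ℕ.≤-refl 3≤n
                    (mk (ℤ∣.divides (+ 2) refl))
  ... | no  3≰n = proj₂ (proj₂ D) 2 (s≤s z≤n) ℕ.≤-refl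
                    (incongruent-mod-2^e 1 n (ℕ.≤-pred (ℕ.≰⇒> 3≰n)))

  D≢2^b*3^[1+k] : ∀ b k → 1 ≤ b ⊎ 1 ≤ k → d ≢ 2 ^ b * 3 ^ suc k
  D≢2^b*3^[1+k] b k b≥1⊎k≥1 refl = no-collision-factored {c = suc k} {M = 2 ^ (b + 2)} incongruent 4d≡
      ℕ.≤-refl (s≤s z≤n) (ℕ.m^n>0 2 (b ∸ 1)) fits 9ᵗ≈1
    where
      t : ℕ
      t = 2 ^ (b ∸ 1)
      4d≡ : 4 * (2 ^ b * 3 ^ suc k) ≡ 3 ^ suc k * 2 ^ (b + 2)
      4d≡ = trans (shuffle (2 ^ b) (3 ^ suc k)) (cong (3 ^ suc k *_) (sym (ℕ.^-distribˡ-+-* 2 b 2)))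
        where shuffle : ∀ x y → 4 * (x * y) ≡ y * (x * 4)
              shuffle = ℕ-Solver.solve-∀
      4t≤ : 4 * t ≤ 2 ^ b * 3 ^ k * 2
      4t≤ = begin
        4 * t                  ≡⟨ ℕ.*-assoc 2 2 t ⟩
        2 * (2 * t)            ≤⟨ ℕ.*-monoʳ-≤ 2 (2*2^[b-1]≤2^b*3^k b k b≥1⊎k≥1) ⟩
        2 * (2 ^ b * 3 ^ k)    ≡⟨ ℕ.*-comm 2 (2 ^ b * 3 ^ k) ⟩
        2 ^ b * 3 ^ k * 2      ∎
        where open ℕ.≤-Reasoning
      fits : suc k + 2 * t ≤ n
      fits = collision-fits {P = 2 ^ b * 3 ^ k} {Q = 3} {i = suc k} {t = t} (s≤s z≤n) (regroup (2 ^ b) (3 ^ k))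
               (ℕ.≤-trans (2*[1+k]≤1+3^k k) (s≤s (ℕ.m≤n*m (3 ^ k) (2 ^ b) {{ℕ.>-nonZero (ℕ.m^n>0 2 b)}}))) 4t≤ d<2n
        where regroup : ∀ x y → x * (3 * y) ≡ x * y * 3
              regroup = ℕ-Solver.solve-∀
      9ᵗ≈1 : (+ 9) ℤ.^ t ≈ + 1 [mod 2 ^ (b + 2) ]
      9ᵗ≈1 = subst (λ e → (+ 9) ℤ.^ e ≈ + 1 [mod 2 ^ (b + 2) ]) (ℕ.*-identityʳ t) (9^[2^[b-1]*g]≈1 b 1)

  D≢2^b*3^c*s : ∀ b c s → 1 ≤ b ⊎ 1 ≤ c → 3 ≤ s → Coprime 2 s → Coprime 3 s → d ≢ 2 ^ b * 3 ^ c * s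
  D≢2^b*3^c*s b c s b≥1⊎c≥1 3≤s 2⊥s 3⊥s refl with half-totient s 3≤s
  ... | g , φ≡2g , 1≤g , 2g<s = no-collision-factored {c = c} {M = 2 ^ (b + 2) * s} incongruent 4d≡
      (ℕ.m≤n⊔m 1 c) (ℕ.m≤m⊔n 1 c) (ℕ.*-mono-≤ (ℕ.m^n>0 2 (b ∸ 1)) 1≤g) fits 9ᵗ≈1
    where
      t : ℕ
      t = 2 ^ (b ∸ 1) * g
      4d≡ : 4 * (2 ^ b * 3 ^ c * s) ≡ 3 ^ c * (2 ^ (b + 2) * s)
      4d≡ = trans (shuffle (2 ^ b) (3 ^ c) s) (cong (λ x → 3 ^ c * (x * s)) (sym (ℕ.^-distribˡ-+-* 2 b 2)))
        where shuffle : ∀ x y s → 4 * (x * y * s) ≡ y * (x * 4 * s)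
              shuffle = ℕ-Solver.solve-∀
      4t≤ : 4 * t ≤ 2 ^ b * 3 ^ c * (s ∸ 1)
      4t≤ = begin
        4 * (2 ^ (b ∸ 1) * g)              ≡⟨ regroup (2 ^ (b ∸ 1)) g ⟩
        (2 * 2 ^ (b ∸ 1)) * (2 * g)        ≤⟨ ℕ.*-mono-≤ (2*2^[b-1]≤2^b*3^k b c b≥1⊎c≥1) (ℕ.∸-monoˡ-≤ 1 2g<s) ⟩
        2 ^ b * 3 ^ c * (s ∸ 1)            ∎
        where
          open ℕ.≤-Reasoning
          regroup : ∀ x g → 4 * (x * g) ≡ (2 * x) * (2 * g)
          regroup = ℕ-Solver.solve-∀
      fits : 1 ⊔ c + 2 * t ≤ n
      fits = collision-fits {P = 2 ^ b * 3 ^ c} {Q = s} {i = 1 ⊔ c} {t = t} (ℕ.≤-trans (s≤s z≤n) 3≤s) refl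
        (ℕ.≤-trans (2*[1⊔c]≤1+3^c c) (s≤s (ℕ.m≤n*m (3 ^ c) (2 ^ b) {{ℕ.>-nonZero (ℕ.m^n>0 2 b)}}))) 4t≤ d<2n
      9ᵗ≈1 : (+ 9) ℤ.^ t ≈ + 1 [mod 2 ^ (b + 2) * s ]
      9ᵗ≈1 = ≈1-coprime-* (coprime-^ˡ (b + 2) 2⊥s) (9^[2^[b-1]*g]≈1 b g)
               (^-*-≈1′ g (2 ^ (b ∸ 1)) (9^half-φ≈1 {g = g} 3⊥s φ≡2g))

  D≢coprime-product : ∀ A B → Coprime A B → 3 ≤ A → 3 ≤ B → Coprime 2 (A * B) → Coprime 3 (A * B) → d ≢ A * B
  D≢coprime-product A B A⊥B 3≤A 3≤B 2⊥AB 3⊥AB refl with half-totient A 3≤A | half-totient B 3≤B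
  ... | gA , φA≡2gA , 1≤gA , 2gA<A | gB , φB≡2gB , 1≤gB , 2gB<B =
    ℕ.<⇒≱ fits (9^k≈1⇒n≤2k incongruent 2⊥AB (ℕ.*-mono-≤ 1≤gA 1≤gB) 9ᵗ≈1)
    where
      t : ℕ
      t = gA * gB
      9ᵗ≈1 : (+ 9) ℤ.^ t ≈ + 1 [mod A * B ]
      9ᵗ≈1 = ≈1-coprime-* A⊥B
        (^-*-≈1 gA gB (9^half-φ≈1 {g = gA} (coprime-∣ʳ 3⊥AB (ℕ∣.m∣m*n B)) φA≡2gA))
        (^-*-≈1′ gB gA (9^half-φ≈1 {g = gB} (coprime-∣ʳ 3⊥AB (ℕ∣.n∣m*n A)) φB≡2gB))
      4t≤ : 4 * t ≤ A * (B ∸ 1)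
      4t≤ = begin
        4 * (gA * gB)          ≡⟨ regroup gA gB ⟩
        (2 * gA) * (2 * gB)    ≤⟨ ℕ.*-mono-≤ (ℕ.<⇒≤ 2gA<A) (ℕ.∸-monoˡ-≤ 1 2gB<B) ⟩
        A * (B ∸ 1)            ∎
        where
          open ℕ.≤-Reasoning
          regroup : ∀ x y → 4 * (x * y) ≡ (2 * x) * (2 * y)
          regroup = ℕ-Solver.solve-∀
      fits : 1 + 2 * t ≤ n
      fits = collision-fits {P = A} {Q = B} {i = 1} {t = t} (ℕ.≤-trans (s≤s z≤n) 3≤B) refl
        (s≤s (ℕ.≤-trans (s≤s z≤n) 3≤A)) 4t≤ d<2n

  private
    rough-D : ∀ s → 2 ≤ s → d ≡ s → ¬ 2 ℕ∣.∣ s → ¬ 3 ℕ∣.∣ s →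
      ∃[ p ] ∃[ a ] Prime p × 5 ≤ p × d ≡ p ^ suc a
    rough-D s 2≤s d≡s 2∤s 3∤s with prime-divisor s 2≤s
    ... | p , p-prime , p∣s with split-power p (prime⇒≥2 p-prime) s (ℕ.≤-trans (s≤s z≤n) 2≤s)
    ...   | zero , r , s≡1*r , p∤r = ⊥-elim (p∤r (subst (p ℕ∣.∣_) (trans s≡1*r (ℕ.*-identityˡ r)) p∣s))
    ...   | suc a , zero , s≡pᵃ*0 , _ =
      ⊥-elim (ℕ.<⇒≱ 2≤s (subst (_≤ 1) (sym (trans s≡pᵃ*0 (ℕ.*-zeroʳ (p ^ suc a)))) z≤n))
    ...   | suc a , suc zero , s≡pᵃ*1 , _ = p , a , p-prime , 5≤p , trans d≡s (trans s≡pᵃ*1 (ℕ.*-identityʳ (p ^ suc a)))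
      where
        5≤p : 5 ≤ p
        5≤p = prime∤6⇒≥5 p-prime (∣⇒∤ p∣s 2∤s) (∣⇒∤ p∣s 3∤s)
    ...   | suc a , r@(suc (suc _)) , s≡pᵃr , p∤r = ⊥-elim (D≢coprime-product (p ^ suc a) r
            (coprime-^ˡ (suc a) (∤⇒coprime p-prime p∤r)) 3≤pᵃ (odd⇒≥3 (s≤s (s≤s z≤n)) (∣⇒∤ r∣s 2∤s))
            (subst (Coprime 2) s≡pᵃr (∤⇒coprime prime[2] 2∤s)) (subst (Coprime 3) s≡pᵃr (∤⇒coprime prime[3] 3∤s))
            (trans d≡s s≡pᵃr))
      where
        r∣s : r ℕ∣.∣ s
        r∣s = ℕ∣.divides (p ^ suc a) s≡pᵃr
        3≤pᵃ : 3 ≤ p ^ suc a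
        3≤pᵃ = ℕ.≤-trans (ℕ.≤-trans (ℕ.m≤n+m 3 2) (prime∤6⇒≥5 p-prime (∣⇒∤ p∣s 2∤s) (∣⇒∤ p∣s 3∤s)))
                 (ℕ.m≤m*n p (p ^ a) {{ℕ.>-nonZero (ℕ.m^n>0 p {{prime⇒nonZero p-prime}} a)}})

    shape : ∀ b c s → 1 < d → d ≡ 2 ^ b * 3 ^ c * s → ¬ 2 ℕ∣.∣ s → ¬ 3 ℕ∣.∣ s →
      (∃[ b ] 1 ≤ b × d ≡ 2 ^ b) ⊎ (∃[ p ] ∃[ a ] Prime p × 5 ≤ p × d ≡ p ^ suc a)
    shape b c zero 1<d d≡ _ _ = ⊥-elim (ℕ.<⇒≢ (ℕ.<-trans (s≤s z≤n) 1<d) (sym (trans d≡ (ℕ.*-zeroʳ (2 ^ b * 3 ^ c)))))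
    shape zero zero (suc zero) 1<d d≡ _ _ = ⊥-elim (ℕ.<⇒≢ 1<d (sym d≡))
    shape (suc b) zero (suc zero) _ d≡ _ _ =
      inj₁ (suc b , s≤s z≤n , trans d≡ (trans (ℕ.*-identityʳ (2 ^ suc b * 1)) (ℕ.*-identityʳ (2 ^ suc b))))
    shape zero (suc zero) (suc zero) _ d≡ _ _ = ⊥-elim (D≢3 d≡)
    shape zero (suc (suc k)) (suc zero) _ d≡ _ _ =
      ⊥-elim (D≢2^b*3^[1+k] zero (suc k) (inj₂ (s≤s z≤n)) (trans d≡ (ℕ.*-identityʳ (1 * 3 ^ suc (suc k)))))
    shape (suc b) (suc k) (suc zero) _ d≡ _ _ =
      ⊥-elim (D≢2^b*3^[1+k] (suc b) k (inj₁ (s≤s z≤n)) (trans d≡ (ℕ.*-identityʳ (2 ^ suc b * 3 ^ suc k))))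
    shape zero zero s@(suc (suc _)) _ d≡ 2∤s 3∤s = inj₂ (rough-D s (s≤s (s≤s z≤n)) (trans d≡ (ℕ.*-identityˡ s)) 2∤s 3∤s)
    shape (suc b) c s@(suc (suc _)) _ d≡ 2∤s 3∤s =
      ⊥-elim (D≢2^b*3^c*s (suc b) c s (inj₁ (s≤s z≤n)) (odd⇒≥3 (s≤s (s≤s z≤n)) 2∤s)
                (∤⇒coprime prime[2] 2∤s) (∤⇒coprime prime[3] 3∤s) d≡)
    shape zero (suc c) s@(suc (suc _)) _ d≡ 2∤s 3∤s =
      ⊥-elim (D≢2^b*3^c*s zero (suc c) s (inj₂ (s≤s z≤n)) (odd⇒≥3 (s≤s (s≤s z≤n)) 2∤s)
                (∤⇒coprime prime[2] 2∤s) (∤⇒coprime prime[3] 3∤s) d≡)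

  D-shape : 1 < d → (∃[ b ] 1 ≤ b × d ≡ 2 ^ b) ⊎ (∃[ p ] ∃[ a ] Prime p × 5 ≤ p × d ≡ p ^ suc a)
  D-shape 1<d with split-power 2 (s≤s (s≤s z≤n)) d (ℕ.<⇒≤ 1<d)
  ... | b , r , d≡2ᵇr , 2∤r with split-power 3 (s≤s (s≤s z≤n)) r 1≤r
    where
      1≤r : 1 ≤ r
      1≤r = ℕ.n≢0⇒n>0 (λ { refl → ℕ.<⇒≢ (ℕ.<-trans (s≤s z≤n) 1<d) (sym (trans d≡2ᵇr (ℕ.*-zeroʳ (2 ^ b)))) })
  ...   | c , s , r≡3ᶜs , 3∤s = shape b c s 1<d d≡2ᵇ3ᶜs (∣⇒∤ s∣r 2∤r) 3∤s
    where
      d≡2ᵇ3ᶜs : d ≡ 2 ^ b * 3 ^ c * s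
      d≡2ᵇ3ᶜs = trans d≡2ᵇr (trans (cong (2 ^ b *_) r≡3ᶜs) (sym (ℕ.*-assoc (2 ^ b) (3 ^ c) s)))
      s∣r : s ℕ∣.∣ r
      s∣r = ℕ∣.divides (3 ^ c) r≡3ᶜs

open import Data.Nat.Base using (_^_; _/_)
open import Data.Sum using (_⊎_)
open import Relation.Nullary using (¬_)
open import Defs using (IsD; IsOrd; φ; _≡_[mod_])
open Arithmetic using (odd-prime)

lemma13 : (q : ℕ) → Prime q → 5 ≤ q → (n d : ℕ) → 1 ≤ n → 1 < d → IsD q n d →
    ∃[ p ] ∃[ m ] (Prime p × (p ≡ 2 ⊎ 3 < p) × 1 ≤ m × d ≡ p ^ m
    × (3 < p →
    IsOrd (p ^ m) 9 (φ (p ^ m) / 2)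
    × IsOrd p 9 ((p ∸ 1) / 2)
    × (2 ≤ m → ¬ ((+ 3) ℤ.^ (p ∸ 1) ≡ + 1 [mod p ^ 2 ]))
    × (p ^ m ≡ q → IsOrd q 3 (q ∸ 1))))
lemma13 q q-prime 5≤q n d 1≤n 1<d D with odd-prime q-prime (ℕ.≤-trans (ℕ.m≤n+m 3 2) 5≤q)
... | h , refl with Classification.D-shape h 1≤n D 1<d
... | inj₁ (b , 1≤b , d≡2ᵇ) = 2 , b , prime[2] , inj₁ refl , 1≤b , d≡2ᵇ , λ { (s≤s (s≤s ())) }
... | inj₂ (p , a , p-prime , 5≤p , refl) with odd-prime p-prime (ℕ.≤-trans (ℕ.m≤n+m 3 2) 5≤p)
...   | hp , refl = p , suc a , p-prime , inj₂ (ℕ.≤-trans (ℕ.n≤1+n 4) 5≤p) , s≤s z≤n , refl ,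
        λ _ → IsOrd-9-pᵃ , IsOrd-9-p , non-Wieferich , IsOrd-3-q q-prime
  where open PrimePowerModulus h {hp = hp} {a₀ = a} p-prime 5≤p 1≤n D using (IsOrd-9-pᵃ; IsOrd-9-p; non-Wieferich; IsOrd-3-q)
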